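{- Let $n \geq 1$, $q = 3^n$, and fix $b \in \mathbb{F}_{3^n}$ with $\lambda_{\mathbb{F}_{3^n}}(b) = (-1)^{n+1}$. Let $j \geq 1$ and let $g_{b,j} : \mathbb{F}_{q^{2j}} \to \mathbb{F}_{q^{2j}}$ be $x \mapsto x^3 + bx$. For $t \in \mathbb{F}_{q^{2j}}$ put $\sigma_b(j,t) = \sum_{x \in \mathbb{F}_{q^{2j}}} \lambda_{\mathbb{F}_{q^{2j}}}(x^3 + bx + t)$. Then for every $t \in \mathbb{F}_{q^{2j}}$, \[ \sigma_b(j,t) = \begin{cases} -2\cdot(-3^n)^j & \text{if } t \in \mathrm{im}(g_{b,j}),\\ (-3^n)^j & \text{otherwise.}\end{cases} \]
   Context: For a finite field $k$ of odd cardinality, $\lambda_k : k \to \{0,\pm1\}$ denotes the Legendre symbol, $\lambda_k(x) = x^{(|k|-1)/2}$ for $x \neq 0$ (the unique character of order 2 of $k^\times$), extended by $\lambda_k(0) = 0$. -}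

module Defs where

open import Level using (0ℓ)
open import Data.Nat as ℕ using (ℕ; zero; suc; _∸_)
import Data.Integer as ℤ
open ℤ using (ℤ; 0ℤ; 1ℤ)
open import Data.List using (List; length; foldr; map)
open import Data.List.Membership.Propositional using (_∈_)
open import Data.List.Relation.Unary.Unique.Propositional using (Unique)
open import Data.Product using (∃)
open import Relation.Nullary using (¬_; Dec; yes; no)
open import Relation.Binary.PropositionalEquality using (_≡_)
import Algebra.Structures as S

record FiniteField : Set₁ where
  field
    Carrier : Set
    _+_ _*_ : Carrier → Carrier → Carrier
    -_ : Carrier → Carrier
    0# 1# : Carrier
    isCommutativeRing : S.IsCommutativeRing {A = Carrier} _≡_ _+_ _*_ -_ 0# 1#
    _≟_ : (x y : Carrier) → Dec (x ≡ y)
    0≢1 : ¬ (0# ≡ 1#)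
    inverse : (x : Carrier) → ¬ (x ≡ 0#) → ∃ λ y → x * y ≡ 1#
    elements : List Carrier
    elements-unique : Unique elements
    elements-complete : (x : Carrier) → x ∈ elements

  infixl 6 _+_
  infixl 7 _*_

  card : ℕ
  card = length elements

  _^_ : Carrier → ℕ → Carrier
  x ^ zero = 1#
  x ^ suc m = x * (x ^ m)

  quadChar : ℕ → Carrier → ℤ
  quadChar r x with x ≟ 0#
  ... | yes _ = 0ℤ
  ... | no _ with (x ^ ((r ∸ 1) ℕ./ 2)) ≟ 1#
  ...   | yes _ = 1ℤ
  ...   | no _ = ℤ.-[1+ 0 ]

  legendre : Carrier → ℤ
  legendre = quadChar card

  sumK : (Carrier → ℤ) → ℤ
  sumK f = foldr (λ x acc → f x ℤ.+ acc) 0ℤ elements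

{-# OPTIONS --safe #-}
module Submission where

-- g x = x ^ 3 + b x is additive in characteristic 3, with kernel {0, s, -s} where s² = -b: since
-- b ^ (q - 1) = 1 and q - 1 divides (|K| - 1) / 2, both b and -b are squares in K. So Im g has
-- index 3. As σ (t + g u) = σ t and, because λ (-1) = 1, σ (-t) = σ t, the sum σ takes one value
-- A on Im g and one value B off it. Summing σ over K gives A = -2B (as ∑ λ = 0), and summing σ²
-- gives B² = |K| = q ^ (2j) (via the Jacobi sums ∑ₜ λ t λ (t + d) = -1 for d ≠ 0). The sign comes
-- from computing A = ∑ λ (x (x² + b)) modulo 8, pairing x with -x and the square roots of z with
-- those of b² / z: A ≡ |K| - 5 + 2 λ r (mod 8) for r² = b, whereas (-q) ^ j ≡ λ r (mod 4).
-- Hence B = (-q) ^ j.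

open import Defs
open import Level using (0ℓ)
open import Algebra.Bundles using (CommutativeRing; CommutativeSemigroup; RawRing)
open import Algebra.Core using (Op₂)
open import Algebra.Structures using (IsCommutativeMonoid; IsCommutativeRing)
import Algebra.Properties.CommutativeSemigroup as CommutativeSemigroupProperties
import Algebra.Properties.Ring as RingProperties
import Algebra.Properties.Semiring.Mult as SemiringMultiplication
import Algebra.Solver.Ring.AlmostCommutativeRing as AlmostCommutativeRing
open import Data.Empty using (⊥; ⊥-elim)
open import Data.Fin using (toℕ)
open import Data.Fin.Properties using (toℕ-injective)
open import Data.Integer as ℤ using (ℤ; 0ℤ; 1ℤ; -1ℤ)
import Data.Integer.Properties as ℤP
open import Data.Integer.Tactic.RingSolver using (solve-∀)
open import Data.List using (List; []; _∷_; length; foldr; lookup)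
open import Data.List.Membership.Propositional using (_∈_)
open import Data.List.Relation.Unary.All using (All; []; _∷_)
open import Data.List.Relation.Unary.All.Properties using (All¬⇒¬Any)
open import Data.List.Relation.Unary.AllPairs using ([]; _∷_)
open import Data.List.Relation.Unary.Any as Any using (here; there; any?)
open import Data.List.Relation.Unary.Any.Properties using (lookup-index)
open import Data.List.Relation.Unary.Unique.Propositional using (Unique)
open import Data.Maybe using (Maybe; just; nothing)
open import Data.Nat as ℕ using (ℕ; zero; suc; z≤n; s≤s; _∸_; _≥_)
import Data.Nat.DivMod as DivMod
import Data.Nat.Divisibility as Divisibility
import Data.Nat.Properties as ℕP
open import Data.Nat.Tactic.RingSolver using () renaming (solve-∀ to ℕ-solve-∀)
open import Data.Product using (∃; _,_; proj₁; proj₂; _×_)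
open import Data.Sum using (_⊎_; inj₁; inj₂; [_,_]′)
open import Function using (_∘_)
open import Relation.Binary.Definitions using (DecidableEquality; tri<; tri≈; tri>)
open import Relation.Binary.PropositionalEquality
open import Relation.Nullary using (¬_; Dec; yes; no; contradiction)
open import Relation.Nullary.Decidable using (¬?; _×-dec_; decidable-stable)

module ListSum {A : Set} {_∙_ : Op₂ A} {ε : A} (isCM : IsCommutativeMonoid _≡_ _∙_ ε) where
  open IsCommutativeMonoid isCM using (identityˡ; identityʳ; isCommutativeSemigroup)

  commutativeSemigroup : CommutativeSemigroup 0ℓ 0ℓ
  commutativeSemigroup = record { isCommutativeSemigroup = isCommutativeSemigroup }

  open CommutativeSemigroupProperties commutativeSemigroup using (interchange)

  sumOver : {X : Set} → List X → (X → A) → A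
  sumOver xs f = foldr (λ x acc → f x ∙ acc) ε xs

  when : {P : Set} → Dec P → A → A
  when (yes _) a = a
  when (no _) _ = ε

  when-yes : ∀ {P : Set} (d : Dec P) {a} → P → when d a ≡ a
  when-yes (yes _) _ = refl
  when-yes (no ¬p) p = ⊥-elim (¬p p)

  when-no : ∀ {P : Set} (d : Dec P) {a} → ¬ P → when d a ≡ ε
  when-no (yes p) ¬p = ⊥-elim (¬p p)
  when-no (no _) _ = refl

  when-cong : ∀ {P R : Set} (dP : Dec P) (dR : Dec R) {a c} → (P → R) → (R → P) → a ≡ c → when dP a ≡ when dR c
  when-cong (yes _) (yes _) _ _ a≡c = a≡c
  when-cong (no _) (no _) _ _ _ = refl
  when-cong (yes p) (no ¬r) p→r _ _ = ⊥-elim (¬r (p→r p))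
  when-cong (no ¬p) (yes r) _ r→p _ = ⊥-elim (¬p (r→p r))

  module _ {X : Set} where

    sumOver-cong : ∀ xs {f g : X → A} → (∀ x → f x ≡ g x) → sumOver xs f ≡ sumOver xs g
    sumOver-cong [] _ = refl
    sumOver-cong (x ∷ xs) f≗g = cong₂ _∙_ (f≗g x) (sumOver-cong xs f≗g)

    sumOver-ε : ∀ xs → sumOver xs (λ (_ : X) → ε) ≡ ε
    sumOver-ε [] = refl
    sumOver-ε (x ∷ xs) = trans (identityˡ _) (sumOver-ε xs)

    sumOver-∙ : ∀ xs (f g : X → A) → sumOver xs (λ x → f x ∙ g x) ≡ sumOver xs f ∙ sumOver xs g
    sumOver-∙ [] f g = sym (identityˡ ε)
    sumOver-∙ (x ∷ xs) f g =
      trans (cong ((f x ∙ g x) ∙_) (sumOver-∙ xs f g)) (interchange _ _ _ _)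

    sumOver-swap : ∀ xs ys (f : X → X → A) →
      sumOver xs (λ x → sumOver ys (f x)) ≡ sumOver ys (λ y → sumOver xs (λ x → f x y))
    sumOver-swap [] ys f = sym (sumOver-ε ys)
    sumOver-swap (x ∷ xs) ys f =
      trans (cong (sumOver ys (f x) ∙_) (sumOver-swap xs ys f))
            (sym (sumOver-∙ ys (f x) (λ y → sumOver xs (λ x′ → f x′ y))))

    module _ (_≟_ : DecidableEquality X) where

      sumOver-when-∉ : ∀ xs a (f : X → A) → ¬ a ∈ xs →
        sumOver xs (λ x → when (x ≟ a) (f x)) ≡ ε
      sumOver-when-∉ [] a f _ = refl
      sumOver-when-∉ (y ∷ ys) a f a∉ with y ≟ a
      ... | yes refl = ⊥-elim (a∉ (here refl))
      ... | no _ = trans (identityˡ _) (sumOver-when-∉ ys a f (a∉ ∘ there))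

      sumOver-when-≡ : ∀ xs a (f : X → A) → Unique xs → a ∈ xs →
        sumOver xs (λ x → when (x ≟ a) (f x)) ≡ f a
      sumOver-when-≡ (y ∷ ys) a f (y∉ys ∷ _) (here refl) with y ≟ y
      ... | no y≢y = ⊥-elim (y≢y refl)
      ... | yes _ = trans (cong (f y ∙_) (sumOver-when-∉ ys y f (All¬⇒¬Any y∉ys))) (identityʳ (f y))
      sumOver-when-≡ (y ∷ ys) a f (y∉ys ∷ unique) (there a∈ys) with y ≟ a
      ... | yes refl = ⊥-elim (All¬⇒¬Any y∉ys a∈ys)
      ... | no _ = trans (identityˡ _) (sumOver-when-≡ ys a f unique a∈ys)

  module Enumeration {X : Set} (_≟_ : DecidableEquality X) (elements : List X)
                     (unique : Unique elements) (complete : ∀ x → x ∈ elements) where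

    ∑ : (X → A) → A
    ∑ = sumOver elements

    ∑-cong : {f g : X → A} → (∀ x → f x ≡ g x) → ∑ f ≡ ∑ g
    ∑-cong = sumOver-cong elements

    ∑-ε : ∑ (λ _ → ε) ≡ ε
    ∑-ε = sumOver-ε elements

    ∑-∙ : (f g : X → A) → ∑ (λ x → f x ∙ g x) ≡ ∑ f ∙ ∑ g
    ∑-∙ = sumOver-∙ elements

    ∑-swap : (f : X → X → A) → ∑ (λ x → ∑ (f x)) ≡ ∑ (λ y → ∑ (λ x → f x y))
    ∑-swap = sumOver-swap elements elements

    ∑-when-≡ : ∀ a (f : X → A) → ∑ (λ x → when (x ≟ a) (f x)) ≡ f a
    ∑-when-≡ a f = sumOver-when-≡ _≟_ elements a f unique (complete a)

    when-≡-sym : ∀ {x y} (a : A) → when (x ≟ y) a ≡ when (y ≟ x) a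
    when-≡-sym {x} {y} a with x ≟ y | y ≟ x
    ... | yes _ | yes _ = refl
    ... | no _ | no _ = refl
    ... | yes x≡y | no y≢x = ⊥-elim (y≢x (sym x≡y))
    ... | no x≢y | yes y≡x = ⊥-elim (x≢y (sym y≡x))

    ∑-fiber : (k : X → X) (h : X → A) → ∑ h ≡ ∑ (λ z → ∑ (λ x → when (k x ≟ z) (h x)))
    ∑-fiber k h = begin
      ∑ h                                           ≡⟨ ∑-cong (λ x → sym (∑-when-≡ (k x) (λ _ → h x))) ⟩
      ∑ (λ x → ∑ (λ z → when (z ≟ k x) (h x)))      ≡⟨ ∑-cong (λ x → ∑-cong (λ z → when-≡-sym (h x))) ⟩
      ∑ (λ x → ∑ (λ z → when (k x ≟ z) (h x)))      ≡⟨ ∑-swap _ ⟩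
      ∑ (λ z → ∑ (λ x → when (k x ≟ z) (h x)))      ∎
      where open ≡-Reasoning

    ∑-reindex : (φ ψ : X → X) → (∀ x → ψ (φ x) ≡ x) → (∀ y → φ (ψ y) ≡ y) →
      (f : X → A) → ∑ (f ∘ φ) ≡ ∑ f
    ∑-reindex φ ψ ψφ φψ f = begin
      ∑ (f ∘ φ)                                     ≡⟨ ∑-cong (λ x → sym (∑-when-≡ (φ x) f)) ⟩
      ∑ (λ x → ∑ (λ y → when (y ≟ φ x) (f y)))      ≡⟨ ∑-swap _ ⟩
      ∑ (λ y → ∑ (λ x → when (y ≟ φ x) (f y)))      ≡⟨ ∑-cong (λ y → ∑-cong (λ x → transpose y x (f y))) ⟩
      ∑ (λ y → ∑ (λ x → when (x ≟ ψ y) (f y)))      ≡⟨ ∑-cong (λ y → ∑-when-≡ (ψ y) (λ _ → f y)) ⟩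
      ∑ f                                           ∎
      where
        open ≡-Reasoning
        transpose : ∀ y x (a : A) → when (y ≟ φ x) a ≡ when (x ≟ ψ y) a
        transpose y x a with y ≟ φ x | x ≟ ψ y
        ... | yes _ | yes _ = refl
        ... | no _ | no _ = refl
        ... | yes refl | no x≢ψy = ⊥-elim (x≢ψy (sym (ψφ x)))
        ... | no y≢φx | yes refl = ⊥-elim (y≢φx (sym (φψ y)))

module IntegerSum {X : Set} (_≟_ : DecidableEquality X) (elements : List X)
                  (unique : Unique elements) (complete : ∀ x → x ∈ elements) where
  open ListSum ℤP.+-0-isCommutativeMonoid public
  open Enumeration _≟_ elements unique complete public

  𝟙 : {P : Set} → Dec P → ℤ
  𝟙 d = when d 1ℤ

  𝟙-nonneg : ∀ {P : Set} (d : Dec P) → 0ℤ ℤ.≤ 𝟙 d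
  𝟙-nonneg (yes _) = ℤ.+≤+ z≤n
  𝟙-nonneg (no _) = ℤ.+≤+ z≤n

  ∑-*ˡ : ∀ c (f : X → ℤ) → ∑ (λ x → c ℤ.* f x) ≡ c ℤ.* ∑ f
  ∑-*ˡ c f = go elements
    where
      go : ∀ xs → sumOver xs (λ x → c ℤ.* f x) ≡ c ℤ.* sumOver xs f
      go [] = sym (ℤP.*-zeroʳ c)
      go (x ∷ xs) = trans (cong (ℤ._+_ (c ℤ.* f x)) (go xs)) (sym (ℤP.*-distribˡ-+ c (f x) _))

  ∑-*ʳ : ∀ c (f : X → ℤ) → ∑ (λ x → f x ℤ.* c) ≡ ∑ f ℤ.* c
  ∑-*ʳ c f = trans (∑-cong (λ x → ℤP.*-comm (f x) c)) (trans (∑-*ˡ c f) (ℤP.*-comm c _))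

  ∑-neg : (f : X → ℤ) → ∑ (λ x → ℤ.- f x) ≡ ℤ.- ∑ f
  ∑-neg f = trans (∑-cong (λ x → sym (ℤP.-1*i≡-i (f x))))
                  (trans (∑-*ˡ -1ℤ f) (ℤP.-1*i≡-i _))

  ∑-sub : (f g : X → ℤ) → ∑ (λ x → f x ℤ.- g x) ≡ ∑ f ℤ.- ∑ g
  ∑-sub f g = trans (∑-∙ f (λ x → ℤ.- g x)) (cong (ℤ._+_ (∑ f)) (∑-neg g))

  ∑-1 : ∑ (λ _ → 1ℤ) ≡ ℤ.+ length elements
  ∑-1 = go elements
    where
      go : ∀ xs → sumOver xs (λ (_ : X) → 1ℤ) ≡ ℤ.+ length xs
      go [] = refl
      go (x ∷ xs) = cong (ℤ._+_ 1ℤ) (go xs)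

  ∑-const : ∀ c → ∑ (λ _ → c) ≡ c ℤ.* ℤ.+ length elements
  ∑-const c = trans (∑-cong (λ _ → sym (ℤP.*-identityʳ c))) (trans (∑-*ˡ c (λ _ → 1ℤ)) (cong (c ℤ.*_) ∑-1))

  ∑-*-∑ : (f g : X → ℤ) → ∑ f ℤ.* ∑ g ≡ ∑ (λ x → ∑ (λ y → f x ℤ.* g y))
  ∑-*-∑ f g = trans (sym (∑-*ʳ (∑ g) f)) (∑-cong (λ x → sym (∑-*ˡ (f x) g)))

  ∑-nonneg-zero : (f : X → ℤ) → (∀ x → 0ℤ ℤ.≤ f x) → ∑ f ≡ 0ℤ → ∀ x → f x ≡ 0ℤ
  ∑-nonneg-zero f f≥0 ∑f≡0 x = go elements ∑f≡0 (complete x)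
    where
      nonneg : ∀ xs → 0ℤ ℤ.≤ sumOver xs f
      nonneg [] = ℤP.≤-refl
      nonneg (y ∷ ys) = ℤP.+-mono-≤ (f≥0 y) (nonneg ys)
      split : ∀ {a b} → 0ℤ ℤ.≤ a → 0ℤ ℤ.≤ b → a ℤ.+ b ≡ 0ℤ → a ≡ 0ℤ × b ≡ 0ℤ
      split {ℤ.+ zero} {ℤ.+ zero} _ _ _ = refl , refl
      split {ℤ.+ zero} {ℤ.+ suc _} _ _ ()
      split {ℤ.+ suc _} {ℤ.+ _} _ _ ()
      go : ∀ xs → sumOver xs f ≡ 0ℤ → x ∈ xs → f x ≡ 0ℤ
      go (y ∷ ys) e (here refl) = proj₁ (split (f≥0 y) (nonneg ys) e)
      go (y ∷ ys) e (there x∈ys) = go ys (proj₂ (split (f≥0 y) (nonneg ys) e)) x∈ys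

  rank : X → ℕ
  rank x = toℕ (Any.index (complete x))

  rank-injective : ∀ {x y} → rank x ≡ rank y → x ≡ y
  rank-injective {x} {y} e = trans (lookup-index (complete x))
    (trans (cong (lookup elements) (toℕ-injective e)) (sym (lookup-index (complete y))))

  -- Sum over one representative of each two-element orbit of an involution.
  halfSum : (X → X) → (X → ℤ) → ℤ
  halfSum ι h = ∑ (λ x → 𝟙 (rank x ℕ.<? rank (ι x)) ℤ.* h x)

  ∑-involution : (ι : X → X) → (∀ x → ι (ι x) ≡ x) → (h : X → ℤ) → (∀ x → h (ι x) ≡ h x) →
    (∀ x → ι x ≡ x → h x ≡ 0ℤ) → ∑ h ≡ ℤ.+ 2 ℤ.* halfSum ι h
  ∑-involution ι ι-involutive h h∘ι≡h h-fixed≡0 = begin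
    ∑ h                                                  ≡⟨ ∑-cong orbit ⟩
    ∑ (λ x → R x ℤ.* h x ℤ.+ R (ι x) ℤ.* h (ι x))        ≡⟨ ∑-∙ (λ x → R x ℤ.* h x) (λ x → R (ι x) ℤ.* h (ι x)) ⟩
    halfSum ι h ℤ.+ ∑ (λ x → R (ι x) ℤ.* h (ι x))        ≡⟨ cong (ℤ._+_ (halfSum ι h))
                                                              (∑-reindex ι ι ι-involutive ι-involutive (λ x → R x ℤ.* h x)) ⟩
    halfSum ι h ℤ.+ halfSum ι h                          ≡⟨ a+a≡2a (halfSum ι h) ⟩
    ℤ.+ 2 ℤ.* halfSum ι h                                ∎
    where
      open ≡-Reasoning
      R : X → ℤ
      R x = 𝟙 (rank x ℕ.<? rank (ι x))
      a+a≡2a : ∀ a → a ℤ.+ a ≡ ℤ.+ 2 ℤ.* a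
      a+a≡2a = solve-∀
      h≡1h+0h : ∀ a → a ≡ 1ℤ ℤ.* a ℤ.+ 0ℤ ℤ.* a
      h≡1h+0h = solve-∀
      h≡0h+1h : ∀ a → a ≡ 0ℤ ℤ.* a ℤ.+ 1ℤ ℤ.* a
      h≡0h+1h = solve-∀
      orbit : ∀ x → h x ≡ R x ℤ.* h x ℤ.+ R (ι x) ℤ.* h (ι x)
      orbit x with ι x ≟ x
      ... | yes ιx≡x = trans (h-fixed≡0 x ιx≡x) (sym (cong₂ ℤ._+_
              (trans (cong (R x ℤ.*_) (h-fixed≡0 x ιx≡x)) (ℤP.*-zeroʳ (R x)))
              (trans (cong (R (ι x) ℤ.*_) (trans (h∘ι≡h x) (h-fixed≡0 x ιx≡x))) (ℤP.*-zeroʳ (R (ι x))))))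
      ... | no ιx≢x rewrite h∘ι≡h x | ι-involutive x with ℕP.<-cmp (rank x) (rank (ι x))
      ...   | tri< x<ιx _ ιx≮x = trans (h≡1h+0h (h x))
              (sym (cong₂ (λ p q → p ℤ.* h x ℤ.+ q ℤ.* h x)
                          (when-yes (rank x ℕ.<? rank (ι x)) x<ιx) (when-no (rank (ι x) ℕ.<? rank x) ιx≮x)))
      ...   | tri≈ _ ranks≡ _ = ⊥-elim (ιx≢x (sym (rank-injective ranks≡)))
      ...   | tri> x≮ιx _ ιx<x = trans (h≡0h+1h (h x))
              (sym (cong₂ (λ p q → p ℤ.* h x ℤ.+ q ℤ.* h x)
                          (when-no (rank x ℕ.<? rank (ι x)) x≮ιx) (when-yes (rank (ι x) ℕ.<? rank x) ιx<x)))

Characteristic3 : FiniteField → Set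
Characteristic3 K = 1# + 1# + 1# ≡ 0#
  where open FiniteField K

module FieldLemmas (K : FiniteField) where
  open FiniteField K public
  open IsCommutativeRing isCommutativeRing public
    using (+-assoc; +-comm; +-identityˡ; +-identityʳ; -‿inverseˡ; -‿inverseʳ;
           *-assoc; *-comm; *-identityˡ; *-identityʳ; zeroˡ; zeroʳ;
           +-isCommutativeMonoid; *-isCommutativeMonoid)

  commutativeRing : CommutativeRing 0ℓ 0ℓ
  commutativeRing = record { isCommutativeRing = isCommutativeRing }

  open CommutativeRing commutativeRing using (ring; semiring)
  open RingProperties ring public
    using (-‿involutive; -0#≈0#; -1*x≈-x; +-inverseˡ-unique; +-identityˡ-unique; x∙y⁻¹≈ε⇒x≈y)

  x*y≡0⇒x≡0∨y≡0 : ∀ {x y} → x * y ≡ 0# → x ≡ 0# ⊎ y ≡ 0#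
  x*y≡0⇒x≡0∨y≡0 {x} {y} xy≡0 with x ≟ 0# | inverse x
  ... | yes x≡0 | _ = inj₁ x≡0
  ... | no x≢0 | inverse-x with inverse-x x≢0
  ... | x′ , xx′≡1 = inj₂ (begin
    y              ≡⟨ sym (*-identityˡ y) ⟩
    1# * y         ≡⟨ cong (_* y) (trans (sym xx′≡1) (*-comm x x′)) ⟩
    (x′ * x) * y   ≡⟨ *-assoc x′ x y ⟩
    x′ * (x * y)   ≡⟨ cong (x′ *_) xy≡0 ⟩
    x′ * 0#        ≡⟨ zeroʳ x′ ⟩
    0#             ∎)
    where open ≡-Reasoning

  *-≢0 : ∀ {x y} → ¬ x ≡ 0# → ¬ y ≡ 0# → ¬ x * y ≡ 0#
  *-≢0 x≢0 y≢0 xy≡0 with x*y≡0⇒x≡0∨y≡0 xy≡0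
  ... | inj₁ x≡0 = x≢0 x≡0
  ... | inj₂ y≡0 = y≢0 y≡0

  -‿≢0 : ∀ {x} → ¬ x ≡ 0# → ¬ - x ≡ 0#
  -‿≢0 {x} x≢0 -x≡0 = x≢0 (trans (sym (-‿involutive x)) (trans (cong -_ -x≡0) -0#≈0#))

  ^-≢0 : ∀ {x} m → ¬ x ≡ 0# → ¬ x ^ m ≡ 0#
  ^-≢0 zero _ 1≡0 = 0≢1 (sym 1≡0)
  ^-≢0 (suc m) x≢0 = *-≢0 x≢0 (^-≢0 m x≢0)

  x^m≡0⇒x≡0 : ∀ {x} m → x ^ m ≡ 0# → x ≡ 0#
  x^m≡0⇒x≡0 {x} m x^m≡0 with x ≟ 0#
  ... | yes x≡0 = x≡0
  ... | no x≢0 = ⊥-elim (^-≢0 m x≢0 x^m≡0)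

  ^-+ : ∀ x a b → x ^ (a ℕ.+ b) ≡ x ^ a * x ^ b
  ^-+ x zero b = sym (*-identityˡ _)
  ^-+ x (suc a) b = trans (cong (x *_) (^-+ x a b)) (sym (*-assoc x _ _))

  *-interchange : ∀ a b c d → (a * b) * (c * d) ≡ (a * c) * (b * d)
  *-interchange a b c d = begin
    (a * b) * (c * d)   ≡⟨ *-assoc a b (c * d) ⟩
    a * (b * (c * d))   ≡⟨ cong (a *_) (sym (*-assoc b c d)) ⟩
    a * ((b * c) * d)   ≡⟨ cong (λ z → a * (z * d)) (*-comm b c) ⟩
    a * ((c * b) * d)   ≡⟨ cong (a *_) (*-assoc c b d) ⟩
    a * (c * (b * d))   ≡⟨ sym (*-assoc a c (b * d)) ⟩
    (a * c) * (b * d)   ∎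
    where open ≡-Reasoning

  *-^ : ∀ x y a → (x * y) ^ a ≡ x ^ a * y ^ a
  *-^ x y zero = sym (*-identityˡ 1#)
  *-^ x y (suc a) = trans (cong ((x * y) *_) (*-^ x y a)) (*-interchange x y (x ^ a) (y ^ a))

  1^ : ∀ a → 1# ^ a ≡ 1#
  1^ zero = refl
  1^ (suc a) = trans (*-identityˡ _) (1^ a)

  ^-* : ∀ x a b → x ^ (a ℕ.* b) ≡ (x ^ a) ^ b
  ^-* x zero b = sym (1^ b)
  ^-* x (suc a) b = trans (^-+ x b (a ℕ.* b))
                          (trans (cong (x ^ b *_) (^-* x a b)) (sym (*-^ x (x ^ a) b)))

  x^a≡1⇒x^ab≡1 : ∀ {x} a b → x ^ a ≡ 1# → x ^ (a ℕ.* b) ≡ 1#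
  x^a≡1⇒x^ab≡1 {x} a b x^a≡1 = trans (^-* x a b) (trans (cong (_^ b) x^a≡1) (1^ b))

  -- Total inverse: 0# ⁻¹ is the junk value 0#.
  _⁻¹ : Carrier → Carrier
  x ⁻¹ with x ≟ 0#
  ... | yes _ = 0#
  ... | no x≢0 = proj₁ (inverse x x≢0)

  infix 8 _⁻¹

  x*x⁻¹≡1 : ∀ {x} → ¬ x ≡ 0# → x * x ⁻¹ ≡ 1#
  x*x⁻¹≡1 {x} x≢0 with x ≟ 0#
  ... | yes x≡0 = ⊥-elim (x≢0 x≡0)
  ... | no x≢0′ = proj₂ (inverse x x≢0′)

  x⁻¹*x≡1 : ∀ {x} → ¬ x ≡ 0# → x ⁻¹ * x ≡ 1#
  x⁻¹*x≡1 x≢0 = trans (*-comm _ _) (x*x⁻¹≡1 x≢0)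

  0⁻¹≡0 : 0# ⁻¹ ≡ 0#
  0⁻¹≡0 with 0# ≟ 0#
  ... | yes _ = refl
  ... | no 0≢0 = ⊥-elim (0≢0 refl)

  ⁻¹-≢0 : ∀ {x} → ¬ x ≡ 0# → ¬ x ⁻¹ ≡ 0#
  ⁻¹-≢0 {x} x≢0 x⁻¹≡0 =
    0≢1 (trans (sym (zeroʳ x)) (trans (cong (x *_) (sym x⁻¹≡0)) (x*x⁻¹≡1 x≢0)))

  *-cancelʳ : ∀ {a d} c → ¬ c ≡ 0# → a * c ≡ d * c → a ≡ d
  *-cancelʳ {a} {d} c c≢0 ac≡dc = begin
    a                 ≡⟨ sym (*-identityʳ a) ⟩
    a * 1#            ≡⟨ cong (a *_) (sym (x*x⁻¹≡1 c≢0)) ⟩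
    a * (c * c ⁻¹)    ≡⟨ sym (*-assoc a c _) ⟩
    (a * c) * c ⁻¹    ≡⟨ cong (_* c ⁻¹) ac≡dc ⟩
    (d * c) * c ⁻¹    ≡⟨ *-assoc d c _ ⟩
    d * (c * c ⁻¹)    ≡⟨ cong (d *_) (x*x⁻¹≡1 c≢0) ⟩
    d * 1#            ≡⟨ *-identityʳ d ⟩
    d                 ∎
    where open ≡-Reasoning

  ⁻¹-unique : ∀ x y → x * y ≡ 1# → y ≡ x ⁻¹
  ⁻¹-unique x y xy≡1 = by-cases (x ≟ 0#)
    where
      by-cases : Dec (x ≡ 0#) → y ≡ x ⁻¹
      by-cases (yes refl) = ⊥-elim (0≢1 (trans (sym (zeroˡ y)) xy≡1))
      by-cases (no x≢0) = *-cancelʳ x x≢0 (trans (*-comm y x) (trans xy≡1 (sym (x⁻¹*x≡1 x≢0))))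

  ⁻¹-involutive : ∀ x → x ⁻¹ ⁻¹ ≡ x
  ⁻¹-involutive x = by-cases (x ≟ 0#)
    where
      by-cases : Dec (x ≡ 0#) → x ⁻¹ ⁻¹ ≡ x
      by-cases (yes refl) = trans (cong _⁻¹ 0⁻¹≡0) 0⁻¹≡0
      by-cases (no x≢0) = sym (⁻¹-unique (x ⁻¹) x (x⁻¹*x≡1 x≢0))

  ⁻¹-injective : ∀ {x y} → x ⁻¹ ≡ y ⁻¹ → x ≡ y
  ⁻¹-injective {x} {y} e = trans (sym (⁻¹-involutive x)) (trans (cong _⁻¹ e) (⁻¹-involutive y))

  ⁻¹-*-distrib : ∀ x y → (x * y) ⁻¹ ≡ x ⁻¹ * y ⁻¹
  ⁻¹-*-distrib x y = by-cases (x ≟ 0#) (y ≟ 0#)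
    where
      by-cases : Dec (x ≡ 0#) → Dec (y ≡ 0#) → (x * y) ⁻¹ ≡ x ⁻¹ * y ⁻¹
      by-cases (yes refl) _ =
        trans (cong _⁻¹ (zeroˡ y)) (trans 0⁻¹≡0 (sym (trans (cong (_* y ⁻¹) 0⁻¹≡0) (zeroˡ _))))
      by-cases (no _) (yes refl) =
        trans (cong _⁻¹ (zeroʳ x)) (trans 0⁻¹≡0 (sym (trans (cong (x ⁻¹ *_) 0⁻¹≡0) (zeroʳ _))))
      by-cases (no x≢0) (no y≢0) = sym (⁻¹-unique (x * y) (x ⁻¹ * y ⁻¹)
        (trans (*-interchange x y (x ⁻¹) (y ⁻¹))
               (trans (cong₂ _*_ (x*x⁻¹≡1 x≢0) (x*x⁻¹≡1 y≢0)) (*-identityˡ 1#))))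

  open IntegerSum _≟_ elements elements-unique elements-complete public
  module Additive = ListSum +-isCommutativeMonoid
  module Multiplicative = ListSum *-isCommutativeMonoid

  open RingProperties ring using (//-rightDividesˡ; //-rightDividesʳ)

  x+u-u≡x : ∀ x u → (x + u) + - u ≡ x
  x+u-u≡x x u = //-rightDividesʳ u x

  x-u+u≡x : ∀ x u → (x + - u) + u ≡ x
  x-u+u≡x x u = //-rightDividesˡ u x

  ∑-translate : (u : Carrier) (f : Carrier → ℤ) → ∑ (λ x → f (x + u)) ≡ ∑ f
  ∑-translate u = ∑-reindex (_+ u) (_+ - u) (λ x → x+u-u≡x x u) (λ y → x-u+u≡x y u)

  x⁻¹*[x*y]≡y : ∀ {x} y → ¬ x ≡ 0# → x ⁻¹ * (x * y) ≡ y
  x⁻¹*[x*y]≡y {x} y x≢0 = trans (sym (*-assoc _ _ _)) (trans (cong (_* y) (x⁻¹*x≡1 x≢0)) (*-identityˡ y))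

  x*[x⁻¹*y]≡y : ∀ {x} y → ¬ x ≡ 0# → x * (x ⁻¹ * y) ≡ y
  x*[x⁻¹*y]≡y {x} y x≢0 = trans (sym (*-assoc _ _ _)) (trans (cong (_* y) (x*x⁻¹≡1 x≢0)) (*-identityˡ y))

  ∑-scale : ∀ {c} → ¬ c ≡ 0# → (f : Carrier → ℤ) → ∑ (λ x → f (c * x)) ≡ ∑ f
  ∑-scale {c} c≢0 = ∑-reindex (c *_) (c ⁻¹ *_) (λ x → x⁻¹*[x*y]≡y x c≢0) (λ y → x*[x⁻¹*y]≡y y c≢0)

  module Product where
    open Multiplicative public using () renaming (sumOver to productOver; when to when*)
    open Multiplicative.Enumeration _≟_ elements elements-unique elements-complete public
      using () renaming (∑ to ∏; ∑-∙ to ∏-∙; ∑-cong to ∏-cong; ∑-reindex to ∏-reindex)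

    nonzeroPart : Carrier → Carrier
    nonzeroPart y = when* (¬? (y ≟ 0#)) y

    nonzeroPart-*ˡ : ∀ {c} y → ¬ c ≡ 0# → nonzeroPart (c * y) ≡ when* (¬? (y ≟ 0#)) c * nonzeroPart y
    nonzeroPart-*ˡ {c} y c≢0 with (c * y) ≟ 0# | y ≟ 0#
    ... | yes _ | yes _ = sym (*-identityˡ 1#)
    ... | no _ | no _ = refl
    ... | yes cy≡0 | no y≢0 = ⊥-elim (*-≢0 c≢0 y≢0 cy≡0)
    ... | no cy≢0 | yes refl = ⊥-elim (cy≢0 (zeroʳ c))

    ∏-nonzeroPart-≢0 : ∀ xs → ¬ productOver xs nonzeroPart ≡ 0#
    ∏-nonzeroPart-≢0 [] 1≡0 = 0≢1 (sym 1≡0)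
    ∏-nonzeroPart-≢0 (y ∷ ys) = *-≢0 (nonzeroPart-≢0 y) (∏-nonzeroPart-≢0 ys)
      where
        nonzeroPart-≢0 : ∀ y → ¬ nonzeroPart y ≡ 0#
        nonzeroPart-≢0 y with y ≟ 0#
        ... | yes _ = λ 1≡0 → 0≢1 (sym 1≡0)
        ... | no y≢0 = y≢0

    ∏-when-≢0-∉ : ∀ c xs → ¬ 0# ∈ xs → productOver xs (λ y → when* (¬? (y ≟ 0#)) c) ≡ c ^ length xs
    ∏-when-≢0-∉ c [] _ = refl
    ∏-when-≢0-∉ c (y ∷ ys) 0∉ with y ≟ 0#
    ... | yes refl = ⊥-elim (0∉ (here refl))
    ... | no _ = cong (c *_) (∏-when-≢0-∉ c ys (0∉ ∘ there))

    ∏-when-≢0 : ∀ c xs → Unique xs → 0# ∈ xs → productOver xs (λ y → when* (¬? (y ≟ 0#)) c) ≡ c ^ (length xs ∸ 1)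
    ∏-when-≢0 c (y ∷ ys) (y∉ys ∷ _) (here refl) with y ≟ 0#
    ... | no y≢y = ⊥-elim (y≢y refl)
    ... | yes _ = trans (*-identityˡ _) (∏-when-≢0-∉ c ys (All¬⇒¬Any y∉ys))
    ∏-when-≢0 c (y ∷ ys) (y∉ys ∷ _) (there 0∈ys) with y ≟ 0#
    ... | yes refl = ⊥-elim (All¬⇒¬Any y∉ys 0∈ys)
    ∏-when-≢0 c (y ∷ z ∷ zs) (_ ∷ unique) (there 0∈ys) | no _ = cong (c *_) (∏-when-≢0 c (z ∷ zs) unique 0∈ys)

  -- Multiplication by x permutes the nonzero elements, so their product picks up a factor x ^ (|K| - 1).
  fermat : ∀ {x} → ¬ x ≡ 0# → x ^ (card ∸ 1) ≡ 1#
  fermat {x} x≢0 = begin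
    x ^ (card ∸ 1)                    ≡⟨ sym (∏-when-≢0 x elements elements-unique (elements-complete 0#)) ⟩
    ∏ (λ y → when* (¬? (y ≟ 0#)) x)   ≡⟨ *-cancelʳ (∏ nonzeroPart) (∏-nonzeroPart-≢0 elements) shifted ⟩
    1#                                ∎
    where
      open ≡-Reasoning
      open Product
      shifted : ∏ (λ y → when* (¬? (y ≟ 0#)) x) * ∏ nonzeroPart ≡ 1# * ∏ nonzeroPart
      shifted = begin
        ∏ (λ y → when* (¬? (y ≟ 0#)) x) * ∏ nonzeroPart   ≡⟨ sym (∏-∙ _ nonzeroPart) ⟩
        ∏ (λ y → when* (¬? (y ≟ 0#)) x * nonzeroPart y)   ≡⟨ ∏-cong (λ y → sym (nonzeroPart-*ˡ y x≢0)) ⟩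
        ∏ (λ y → nonzeroPart (x * y))                     ≡⟨ ∏-reindex (x *_) (x ⁻¹ *_) (λ y → x⁻¹*[x*y]≡y y x≢0)
                                                                        (λ y → x*[x⁻¹*y]≡y y x≢0) nonzeroPart ⟩
        ∏ nonzeroPart                                     ≡⟨ sym (*-identityˡ _) ⟩
        1# * ∏ nonzeroPart                                ∎

  open SemiringMultiplication semiring using (×1-homo-*) renaming (_×_ to _·_)

  -- x ↦ x + 1 permutes K, so adding 1 to every element does not change ∑ x.
  card·1≡0 : card · 1# ≡ 0#
  card·1≡0 = +-identityˡ-unique (card · 1#) (Sum.∑ (λ x → x)) (begin
    card · 1# + Sum.∑ (λ x → x)            ≡⟨ +-comm _ _ ⟩
    Sum.∑ (λ x → x) + card · 1#            ≡⟨ cong (Sum.∑ (λ x → x) +_) (sym (sumOver-1# elements)) ⟩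
    Sum.∑ (λ x → x) + Sum.∑ (λ _ → 1#)     ≡⟨ sym (Sum.∑-∙ (λ x → x) (λ _ → 1#)) ⟩
    Sum.∑ (λ x → x + 1#)                   ≡⟨ Sum.∑-reindex (_+ 1#) (_+ - 1#) (λ x → x+u-u≡x x 1#) (λ x → x-u+u≡x x 1#) (λ x → x) ⟩
    Sum.∑ (λ x → x)                        ∎)
    where
      open ≡-Reasoning
      module Sum = Additive.Enumeration _≟_ elements elements-unique elements-complete
      sumOver-1# : ∀ xs → Additive.sumOver xs (λ _ → 1#) ≡ length xs · 1#
      sumOver-1# [] = refl
      sumOver-1# (x ∷ xs) = cong (1# +_) (sumOver-1# xs)

  ^·1 : ∀ a m → (a ℕ.^ m) · 1# ≡ (a · 1#) ^ m
  ^·1 a zero = +-identityʳ 1#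
  ^·1 a (suc m) = trans (×1-homo-* a (a ℕ.^ m)) (cong ((a · 1#) *_) (^·1 a m))

  card≡3^m⇒characteristic3 : ∀ m → card ≡ 3 ℕ.^ m → Characteristic3 K
  card≡3^m⇒characteristic3 m card≡3^m = begin
    1# + 1# + 1#      ≡⟨ trans (+-assoc 1# 1# 1#) (cong (λ z → 1# + (1# + z)) (sym (+-identityʳ 1#))) ⟩
    3 · 1#            ≡⟨ x^m≡0⇒x≡0 m (trans (sym (^·1 3 m)) (trans (cong (_· 1#) (sym card≡3^m)) card·1≡0)) ⟩
    0#                ∎
    where open ≡-Reasoning

module Characteristic3Solver (K : FiniteField) (char3 : Characteristic3 K) where
  open FieldLemmas K

  data 𝔽₃ : Set where
    0₃ 1₃ -1₃ : 𝔽₃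

  _+₃_ : 𝔽₃ → 𝔽₃ → 𝔽₃
  0₃ +₃ y = y
  1₃ +₃ 0₃ = 1₃
  1₃ +₃ 1₃ = -1₃
  1₃ +₃ -1₃ = 0₃
  -1₃ +₃ 0₃ = -1₃
  -1₃ +₃ 1₃ = 0₃
  -1₃ +₃ -1₃ = 1₃

  _*₃_ : 𝔽₃ → 𝔽₃ → 𝔽₃
  0₃ *₃ _ = 0₃
  1₃ *₃ y = y
  -1₃ *₃ 0₃ = 0₃
  -1₃ *₃ 1₃ = -1₃
  -1₃ *₃ -1₃ = 1₃

  -₃_ : 𝔽₃ → 𝔽₃
  -₃ 0₃ = 0₃
  -₃ 1₃ = -1₃
  -₃ -1₃ = 1₃

  𝔽₃-rawRing : RawRing 0ℓ 0ℓ
  𝔽₃-rawRing = record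
    { Carrier = 𝔽₃ ; _≈_ = _≡_ ; _+_ = _+₃_ ; _*_ = _*₃_ ; -_ = -₃_ ; 0# = 0₃ ; 1# = 1₃ }

  1+1≡-1 : 1# + 1# ≡ - 1#
  1+1≡-1 = +-inverseˡ-unique (1# + 1#) 1# char3

  -1+-1≡1 : - 1# + - 1# ≡ 1#
  -1+-1≡1 = begin
    - 1# + - 1#         ≡⟨ cong (_+ - 1#) (sym 1+1≡-1) ⟩
    (1# + 1#) + - 1#    ≡⟨ x+u-u≡x 1# 1# ⟩
    1#                  ∎
    where open ≡-Reasoning

  -1*-1≡1 : - 1# * - 1# ≡ 1#
  -1*-1≡1 = trans (-1*x≈-x (- 1#)) (-‿involutive 1#)

  ⟦_⟧ : 𝔽₃ → Carrier
  ⟦ 0₃ ⟧ = 0#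
  ⟦ 1₃ ⟧ = 1#
  ⟦ -1₃ ⟧ = - 1#

  ⟦⟧-+ : ∀ a b → ⟦ a +₃ b ⟧ ≡ ⟦ a ⟧ + ⟦ b ⟧
  ⟦⟧-+ 0₃ b = sym (+-identityˡ _)
  ⟦⟧-+ 1₃ 0₃ = sym (+-identityʳ _)
  ⟦⟧-+ 1₃ 1₃ = sym 1+1≡-1
  ⟦⟧-+ 1₃ -1₃ = sym (-‿inverseʳ 1#)
  ⟦⟧-+ -1₃ 0₃ = sym (+-identityʳ _)
  ⟦⟧-+ -1₃ 1₃ = sym (-‿inverseˡ 1#)
  ⟦⟧-+ -1₃ -1₃ = sym -1+-1≡1

  ⟦⟧-* : ∀ a b → ⟦ a *₃ b ⟧ ≡ ⟦ a ⟧ * ⟦ b ⟧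
  ⟦⟧-* 0₃ b = sym (zeroˡ _)
  ⟦⟧-* 1₃ b = sym (*-identityˡ _)
  ⟦⟧-* -1₃ 0₃ = sym (zeroʳ _)
  ⟦⟧-* -1₃ 1₃ = sym (*-identityʳ _)
  ⟦⟧-* -1₃ -1₃ = sym -1*-1≡1

  ⟦⟧-neg : ∀ a → ⟦ -₃ a ⟧ ≡ - ⟦ a ⟧
  ⟦⟧-neg 0₃ = sym -0#≈0#
  ⟦⟧-neg 1₃ = refl
  ⟦⟧-neg -1₃ = sym (-‿involutive 1#)

  ⟦⟧-homomorphism : 𝔽₃-rawRing AlmostCommutativeRing.-Raw-AlmostCommutative⟶
                    AlmostCommutativeRing.fromCommutativeRing commutativeRing
  ⟦⟧-homomorphism = record
    { ⟦_⟧ = ⟦_⟧ ; +-homo = ⟦⟧-+ ; *-homo = ⟦⟧-* ; -‿homo = ⟦⟧-neg ; 0-homo = refl ; 1-homo = refl }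

  ⟦⟧-≟ : ∀ a b → Maybe (⟦ a ⟧ ≡ ⟦ b ⟧)
  ⟦⟧-≟ 0₃ 0₃ = just refl
  ⟦⟧-≟ 1₃ 1₃ = just refl
  ⟦⟧-≟ -1₃ -1₃ = just refl
  ⟦⟧-≟ _ _ = nothing

  open import Algebra.Solver.Ring 𝔽₃-rawRing (AlmostCommutativeRing.fromCommutativeRing commutativeRing)
    ⟦⟧-homomorphism ⟦⟧-≟ public using (solve; _:=_; _:+_; _:*_; :-_; con)

module QuadCharView (K : FiniteField) where
  open FiniteField K

  data QuadCharView (r : ℕ) (x : Carrier) : Set where
    zero    : x ≡ 0# → quadChar r x ≡ 0ℤ → QuadCharView r x
    residue : ¬ x ≡ 0# → x ^ ((r ∸ 1) ℕ./ 2) ≡ 1# → quadChar r x ≡ 1ℤ → QuadCharView r x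
    nonresidue : ¬ x ≡ 0# → ¬ x ^ ((r ∸ 1) ℕ./ 2) ≡ 1# → quadChar r x ≡ -1ℤ → QuadCharView r x

  quadChar-view : ∀ r x → QuadCharView r x
  quadChar-view r x with x ≟ 0# in x≟0
  ... | yes x≡0 = zero x≡0 (by-zero x≟0)
    where
      by-zero : x ≟ 0# ≡ yes x≡0 → quadChar r x ≡ 0ℤ
      by-zero eq rewrite eq = refl
  ... | no x≢0 with (x ^ ((r ∸ 1) ℕ./ 2)) ≟ 1# in x^≟1
  ...   | yes x^≡1 = residue x≢0 x^≡1 (by-value x≟0 x^≟1)
    where
      by-value : x ≟ 0# ≡ no x≢0 → (x ^ ((r ∸ 1) ℕ./ 2)) ≟ 1# ≡ yes x^≡1 → quadChar r x ≡ 1ℤ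
      by-value eq eq′ rewrite eq | eq′ = refl
  ...   | no x^≢1 = nonresidue x≢0 x^≢1 (by-value x≟0 x^≟1)
    where
      by-value : x ≟ 0# ≡ no x≢0 → (x ^ ((r ∸ 1) ℕ./ 2)) ≟ 1# ≡ no x^≢1 → quadChar r x ≡ -1ℤ
      by-value eq eq′ rewrite eq | eq′ = refl

module Characteristic3Field (K : FiniteField) (char3 : Characteristic3 K) where
  open FieldLemmas K public
  open Characteristic3Solver K char3 public

  search : (P : Carrier → Set) → (∀ x → Dec (P x)) → Dec (∃ P)
  search P P? with any? P? elements
  ... | yes p∈ = yes (Any.satisfied p∈)
  ... | no ¬p∈ = no (λ { (x , px) → ¬p∈ (Any.map (λ { refl → px }) (elements-complete x)) })

  x≢0⇒x≢-x : ∀ {x} → ¬ x ≡ 0# → ¬ x ≡ - x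
  x≢0⇒x≢-x {x} x≢0 x≡-x = x≢0 (begin
    x             ≡⟨ solve 1 (λ x → x := (:- (x :+ x))) refl x ⟩
    - (x + x)     ≡⟨ cong (λ z → - (x + z)) x≡-x ⟩
    - (x + - x)   ≡⟨ cong -_ (-‿inverseʳ x) ⟩
    - 0#          ≡⟨ -0#≈0# ⟩
    0#            ∎)
    where open ≡-Reasoning

  x-y≡0⇒x≡y : ∀ {x y} → x + - y ≡ 0# → x ≡ y
  x-y≡0⇒x≡y = x∙y⁻¹≈ε⇒x≈y _ _

  x*x≡y*y⇒x≡±y : ∀ {x y} → x * x ≡ y * y → x ≡ y ⊎ x ≡ - y
  x*x≡y*y⇒x≡±y {x} {y} xx≡yy with x*y≡0⇒x≡0∨y≡0 difference-of-squares
    where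
      difference-of-squares : (x + - y) * (x + y) ≡ 0#
      difference-of-squares = begin
        (x + - y) * (x + y)   ≡⟨ solve 2 (λ x y → ((x :+ :- y) :* (x :+ y)) := (x :* x :+ :- (y :* y))) refl x y ⟩
        x * x + - (y * y)     ≡⟨ cong (λ z → z + - (y * y)) xx≡yy ⟩
        y * y + - (y * y)     ≡⟨ -‿inverseʳ (y * y) ⟩
        0#                    ∎
        where open ≡-Reasoning
  ... | inj₁ x-y≡0 = inj₁ (x-y≡0⇒x≡y x-y≡0)
  ... | inj₂ x+y≡0 = inj₂ (+-inverseˡ-unique x y x+y≡0)

  u*u≡1⇒u≡±1 : ∀ {u} → u * u ≡ 1# → u ≡ 1# ⊎ u ≡ - 1#
  u*u≡1⇒u≡±1 uu≡1 = x*x≡y*y⇒x≡±y (trans uu≡1 (sym (*-identityˡ 1#)))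

  -1≢1 : ¬ - 1# ≡ 1#
  -1≢1 -1≡1 = x≢0⇒x≢-x (λ 1≡0 → 0≢1 (sym 1≡0)) (sym -1≡1)

  -x*-x≡x*x : ∀ x → - x * - x ≡ x * x
  -x*-x≡x*x = solve 1 (λ x → ((:- x) :* (:- x)) := (x :* x)) refl

  -- Polynomials are coefficient lists, constant coefficient first.
  eval : List Carrier → Carrier → Carrier
  eval [] x = 0#
  eval (c ∷ p) x = c + x * eval p x

  divideBy : Carrier → List Carrier → List Carrier
  divideBy r [] = []
  divideBy r (c ∷ []) = []
  divideBy r (c ∷ d ∷ p) = eval (d ∷ p) r ∷ divideBy r (d ∷ p)

  eval-divideBy : ∀ r p x → eval p x ≡ (x + - r) * eval (divideBy r p) x + eval p r
  eval-divideBy r [] x = solve 2 (λ x r → con 0₃ := ((x :+ :- r) :* con 0₃ :+ con 0₃)) refl x r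
  eval-divideBy r (c ∷ []) x =
    solve 3 (λ c x r → (c :+ x :* con 0₃) := ((x :+ :- r) :* con 0₃ :+ (c :+ r :* con 0₃))) refl c x r
  eval-divideBy r (c ∷ d ∷ p) x = trans (cong (λ z → c + x * z) (eval-divideBy r (d ∷ p) x))
    (solve 5 (λ c x r q v → (c :+ x :* ((x :+ :- r) :* q :+ v))
                         := ((x :+ :- r) :* (v :+ x :* q) :+ (c :+ r :* v)))
       refl c x r (eval (divideBy r (d ∷ p)) x) (eval (d ∷ p) r))

  length-divideBy : ∀ r p → length (divideBy r p) ≡ length p ∸ 1
  length-divideBy r [] = refl
  length-divideBy r (c ∷ []) = refl
  length-divideBy r (c ∷ d ∷ p) = cong suc (length-divideBy r (d ∷ p))

  divideBy-zero : ∀ r p → All (_≡ 0#) (divideBy r p) → eval p r ≡ 0# → All (_≡ 0#) p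
  divideBy-zero r [] _ _ = []
  divideBy-zero r (c ∷ []) _ c+r*0≡0 =
    trans (sym (trans (cong (c +_) (zeroʳ r)) (+-identityʳ c))) c+r*0≡0 ∷ []
  divideBy-zero r (c ∷ d ∷ p) (q≡0 ∷ qs≡0) c+r*q≡0 =
    trans (sym (trans (cong (λ z → c + r * z) q≡0) (trans (cong (c +_) (zeroʳ r)) (+-identityʳ c)))) c+r*q≡0
    ∷ divideBy-zero r (d ∷ p) qs≡0 q≡0

  -- length p exceeds the degree of p by one.
  vanishes-on-roots⇒zero : ∀ rs → Unique rs → ∀ p → length p ℕ.≤ length rs →
    All (λ r → eval p r ≡ 0#) rs → All (_≡ 0#) p
  vanishes-on-roots⇒zero [] _ [] _ _ = []
  vanishes-on-roots⇒zero (r ∷ rs) _ [] _ _ = []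
  vanishes-on-roots⇒zero (r ∷ rs) (r∉rs ∷ unique) (c ∷ p) (s≤s length≤) (root ∷ roots) =
    divideBy-zero r (c ∷ p)
      (vanishes-on-roots⇒zero rs unique (divideBy r (c ∷ p))
        (subst (ℕ._≤ length rs) (sym (length-divideBy r (c ∷ p))) length≤)
        (quotient-roots rs r∉rs roots))
      root
    where
      quotient-roots : ∀ xs → All (λ z → ¬ r ≡ z) xs → All (λ z → eval (c ∷ p) z ≡ 0#) xs →
        All (λ z → eval (divideBy r (c ∷ p)) z ≡ 0#) xs
      quotient-roots [] [] [] = []
      quotient-roots (x ∷ xs) (r≢x ∷ r∉xs) (x-root ∷ xs-roots) =
        quotient-root ∷ quotient-roots xs r∉xs xs-roots
        where
          product≡0 : (x + - r) * eval (divideBy r (c ∷ p)) x ≡ 0#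
          product≡0 = begin
            (x + - r) * eval (divideBy r (c ∷ p)) x                 ≡⟨ sym (+-identityʳ _) ⟩
            (x + - r) * eval (divideBy r (c ∷ p)) x + 0#            ≡⟨ cong ((x + - r) * eval (divideBy r (c ∷ p)) x +_) (sym root) ⟩
            (x + - r) * eval (divideBy r (c ∷ p)) x + eval (c ∷ p) r ≡⟨ sym (eval-divideBy r (c ∷ p) x) ⟩
            eval (c ∷ p) x                                          ≡⟨ x-root ⟩
            0#                                                      ∎
            where open ≡-Reasoning
          quotient-root : eval (divideBy r (c ∷ p)) x ≡ 0#
          quotient-root with x*y≡0⇒x≡0∨y≡0 product≡0
          ... | inj₁ x-r≡0 = ⊥-elim (r≢x (sym (x-y≡0⇒x≡y x-r≡0)))
          ... | inj₂ q≡0 = q≡0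

  monomial : ℕ → List Carrier
  monomial zero = 1# ∷ []
  monomial (suc k) = 0# ∷ monomial k

  eval-monomial : ∀ k x → eval (monomial k) x ≡ x ^ k
  eval-monomial zero x = trans (cong (1# +_) (zeroʳ x)) (+-identityʳ 1#)
  eval-monomial (suc k) x = trans (+-identityˡ _) (cong (x *_) (eval-monomial k x))

  length-monomial : ∀ k → length (monomial k) ≡ suc k
  length-monomial zero = refl
  length-monomial (suc k) = cong suc (length-monomial k)

  monomial≢0 : ∀ k → ¬ All (_≡ 0#) (monomial k)
  monomial≢0 zero (1≡0 ∷ _) = 0≢1 (sym 1≡0)
  monomial≢0 (suc k) (_ ∷ rest) = monomial≢0 k rest

[1+2a∸1]/2≡a : ∀ a → (suc (a ℕ.+ a) ∸ 1) ℕ./ 2 ≡ a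
[1+2a∸1]/2≡a a = trans (cong (ℕ._/ 2) (trans (cong (a ℕ.+_) (sym (ℕP.+-identityʳ a))) (ℕP.*-comm 2 a)))
                       (DivMod.m*n/n≡m a 2)

module QuadraticCharacter (K : FiniteField) (char3 : Characteristic3 K)
                          (e : ℕ) (card≡1+2e : FiniteField.card K ≡ suc (e ℕ.+ e)) (e≥1 : 1 ℕ.≤ e) where
  open Characteristic3Field K char3 public
  open QuadCharView K public

  χ : Carrier → Carrier
  χ x = x ^ e

  [card∸1]/2≡e : (card ∸ 1) ℕ./ 2 ≡ e
  [card∸1]/2≡e = trans (cong (λ c → (c ∸ 1) ℕ./ 2) card≡1+2e) ([1+2a∸1]/2≡a e)

  χ-* : ∀ x y → χ (x * y) ≡ χ x * χ y
  χ-* x y = *-^ x y e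

  χ*χ≡1 : ∀ {x} → ¬ x ≡ 0# → χ x * χ x ≡ 1#
  χ*χ≡1 {x} x≢0 = trans (sym (^-+ x e e)) (trans (cong (x ^_) (sym (cong (_∸ 1) card≡1+2e))) (fermat x≢0))

  χ≡±1 : ∀ {x} → ¬ x ≡ 0# → χ x ≡ 1# ⊎ χ x ≡ - 1#
  χ≡±1 x≢0 = u*u≡1⇒u≡±1 (χ*χ≡1 x≢0)

  -- Otherwise x (x ^ e - 1), of degree e + 1 < |K|, would vanish on all of K.
  nonresidue-exists : ∃ λ c → ¬ c ≡ 0# × ¬ χ c ≡ 1#
  nonresidue-exists with search (λ c → ¬ c ≡ 0# × ¬ χ c ≡ 1#) (λ c → ¬? (c ≟ 0#) ×-dec ¬? (χ c ≟ 1#))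
  ... | yes found = found
  ... | no none = ⊥-elim (no-nonresidue e≥1 refl)
    where
      zero-or-residue : ∀ x → x ≡ 0# ⊎ χ x ≡ 1#
      zero-or-residue x with x ≟ 0# | χ x ≟ 1#
      ... | yes x≡0 | _ = inj₁ x≡0
      ... | no _ | yes χx≡1 = inj₂ χx≡1
      ... | no x≢0 | no χx≢1 = ⊥-elim (none (x , x≢0 , χx≢1))
      no-nonresidue : ∀ {k} → 1 ℕ.≤ k → k ≡ e → ⊥
      no-nonresidue {suc k} _ refl = monomial≢0 k (drop-2 (vanishes-on-roots⇒zero elements elements-unique P length-P (all-roots elements)))
        where
          P : List Carrier
          P = 0# ∷ - 1# ∷ monomial k
          drop-2 : All (_≡ 0#) P → All (_≡ 0#) (monomial k)
          drop-2 (_ ∷ _ ∷ rest) = rest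
          length-P : length P ℕ.≤ length elements
          length-P = subst₂ ℕ._≤_ (cong (suc ∘ suc) (sym (length-monomial k))) (sym card≡1+2e)
                       (s≤s (s≤s (subst (suc k ℕ.≤_) (sym (ℕP.+-suc k k)) (s≤s (ℕP.m≤m+n k k)))))
          eval-P : ∀ x → eval P x ≡ 0#
          eval-P x with zero-or-residue x
          ... | inj₁ refl = trans (cong (0# +_) (zeroˡ _)) (+-identityʳ 0#)
          ... | inj₂ χx≡1 = begin
            0# + x * (- 1# + x * eval (monomial k) x)  ≡⟨ cong (λ z → 0# + x * (- 1# + x * z)) (eval-monomial k x) ⟩
            0# + x * (- 1# + χ x)                      ≡⟨ cong (λ z → 0# + x * (- 1# + z)) χx≡1 ⟩
            0# + x * (- 1# + 1#)                       ≡⟨ cong (λ z → 0# + x * z) (-‿inverseˡ 1#) ⟩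
            0# + x * 0#                                ≡⟨ trans (+-identityˡ _) (zeroʳ x) ⟩
            0#                                         ∎
            where open ≡-Reasoning
          all-roots : ∀ xs → All (λ r → eval P r ≡ 0#) xs
          all-roots [] = []
          all-roots (x ∷ xs) = eval-P x ∷ all-roots xs

  data LegendreView (x : Carrier) : Set where
    zero       : x ≡ 0# → legendre x ≡ 0ℤ → LegendreView x
    residue    : ¬ x ≡ 0# → χ x ≡ 1# → legendre x ≡ 1ℤ → LegendreView x
    nonresidue : ¬ x ≡ 0# → χ x ≡ - 1# → legendre x ≡ -1ℤ → LegendreView x

  legendre-view : ∀ x → LegendreView x
  legendre-view x with quadChar-view card x
  ... | zero x≡0 λx≡0 = zero x≡0 λx≡0
  ... | residue x≢0 x^≡1 λx≡1 = residue x≢0 (subst (λ m → x ^ m ≡ 1#) [card∸1]/2≡e x^≡1) λx≡1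
  ... | nonresidue x≢0 x^≢1 λx≡-1 with χ≡±1 x≢0
  ...   | inj₁ χx≡1 = ⊥-elim (x^≢1 (subst (λ m → x ^ m ≡ 1#) (sym [card∸1]/2≡e) χx≡1))
  ...   | inj₂ χx≡-1 = nonresidue x≢0 χx≡-1 λx≡-1

  legendre-0 : ∀ {x} → x ≡ 0# → legendre x ≡ 0ℤ
  legendre-0 {x} x≡0 with legendre-view x
  ... | zero _ λx≡0 = λx≡0
  ... | residue x≢0 _ _ = ⊥-elim (x≢0 x≡0)
  ... | nonresidue x≢0 _ _ = ⊥-elim (x≢0 x≡0)

  legendre-residue : ∀ {x} → ¬ x ≡ 0# → χ x ≡ 1# → legendre x ≡ 1ℤ
  legendre-residue {x} x≢0 χx≡1 with legendre-view x
  ... | zero x≡0 _ = ⊥-elim (x≢0 x≡0)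
  ... | residue _ _ λx≡1 = λx≡1
  ... | nonresidue _ χx≡-1 _ = ⊥-elim (-1≢1 (trans (sym χx≡-1) χx≡1))

  legendre-nonresidue : ∀ {x} → ¬ x ≡ 0# → χ x ≡ - 1# → legendre x ≡ -1ℤ
  legendre-nonresidue {x} x≢0 χx≡-1 with legendre-view x
  ... | zero x≡0 _ = ⊥-elim (x≢0 x≡0)
  ... | residue _ χx≡1 _ = ⊥-elim (-1≢1 (trans (sym χx≡-1) χx≡1))
  ... | nonresidue _ _ λx≡-1 = λx≡-1

  legendre-* : ∀ x y → legendre (x * y) ≡ legendre x ℤ.* legendre y
  legendre-* x y with legendre-view x | legendre-view y
  ... | zero refl λx≡0 | _ =
    trans (legendre-0 (zeroˡ y)) (sym (trans (cong (ℤ._* legendre y) λx≡0) (ℤP.*-zeroˡ (legendre y))))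
  ... | residue _ _ _ | zero refl λy≡0 =
    trans (legendre-0 (zeroʳ x)) (sym (trans (cong (legendre x ℤ.*_) λy≡0) (ℤP.*-zeroʳ (legendre x))))
  ... | nonresidue _ _ _ | zero refl λy≡0 =
    trans (legendre-0 (zeroʳ x)) (sym (trans (cong (legendre x ℤ.*_) λy≡0) (ℤP.*-zeroʳ (legendre x))))
  ... | residue x≢0 χx λx | residue y≢0 χy λy =
    trans (legendre-residue (*-≢0 x≢0 y≢0) (trans (χ-* x y) (trans (cong₂ _*_ χx χy) (*-identityˡ 1#))))
          (sym (cong₂ ℤ._*_ λx λy))
  ... | residue x≢0 χx λx | nonresidue y≢0 χy λy =
    trans (legendre-nonresidue (*-≢0 x≢0 y≢0) (trans (χ-* x y) (trans (cong₂ _*_ χx χy) (*-identityˡ _))))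
          (sym (cong₂ ℤ._*_ λx λy))
  ... | nonresidue x≢0 χx λx | residue y≢0 χy λy =
    trans (legendre-nonresidue (*-≢0 x≢0 y≢0) (trans (χ-* x y) (trans (cong₂ _*_ χx χy) (*-identityʳ _))))
          (sym (cong₂ ℤ._*_ λx λy))
  ... | nonresidue x≢0 χx λx | nonresidue y≢0 χy λy =
    trans (legendre-residue (*-≢0 x≢0 y≢0) (trans (χ-* x y) (trans (cong₂ _*_ χx χy) -1*-1≡1)))
          (sym (cong₂ ℤ._*_ λx λy))

  legendre*legendre≡1 : ∀ {x} → ¬ x ≡ 0# → legendre x ℤ.* legendre x ≡ 1ℤ
  legendre*legendre≡1 {x} x≢0 with legendre-view x
  ... | zero x≡0 _ = ⊥-elim (x≢0 x≡0)
  ... | residue _ _ λx≡1 = cong₂ ℤ._*_ λx≡1 λx≡1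
  ... | nonresidue _ _ λx≡-1 = cong₂ ℤ._*_ λx≡-1 λx≡-1

  legendre-square : ∀ {x} → ¬ x ≡ 0# → legendre (x * x) ≡ 1ℤ
  legendre-square {x} x≢0 = trans (legendre-* x x) (legendre*legendre≡1 x≢0)

  legendre-square-* : ∀ {c} y → ¬ c ≡ 0# → legendre ((c * c) * y) ≡ legendre y
  legendre-square-* {c} y c≢0 =
    trans (legendre-* (c * c) y) (trans (cong (ℤ._* legendre y) (legendre-square c≢0)) (ℤP.*-identityˡ _))

  -- Multiplying by a nonresidue permutes K and negates the Legendre symbol.
  ∑-legendre : ∑ legendre ≡ 0ℤ
  ∑-legendre = s≡-s⇒s≡0 (begin
    ∑ legendre                       ≡⟨ sym (∑-scale c≢0 legendre) ⟩
    ∑ (λ x → legendre (c * x))       ≡⟨ ∑-cong (λ x → trans (legendre-* c x) (trans (cong (ℤ._* legendre x) λc≡-1) (ℤP.-1*i≡-i _))) ⟩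
    ∑ (λ x → ℤ.- legendre x)         ≡⟨ ∑-neg legendre ⟩
    ℤ.- ∑ legendre                   ∎)
    where
      open ≡-Reasoning
      c = proj₁ nonresidue-exists
      c≢0 = proj₁ (proj₂ nonresidue-exists)
      λc≡-1 : legendre c ≡ -1ℤ
      λc≡-1 with χ≡±1 c≢0
      ... | inj₁ χc≡1 = ⊥-elim (proj₂ (proj₂ nonresidue-exists) χc≡1)
      ... | inj₂ χc≡-1 = legendre-nonresidue c≢0 χc≡-1
      s≡-s⇒s≡0 : ∀ {s} → s ≡ ℤ.- s → s ≡ 0ℤ
      s≡-s⇒s≡0 {ℤ.+ zero} _ = refl
      s≡-s⇒s≡0 {ℤ.+ suc _} ()
      s≡-s⇒s≡0 {ℤ.-[1+ _ ]} ()

  nonzero : Carrier → ℤ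
  nonzero x = 𝟙 (¬? (x ≟ 0#))

  ∑-nonzero : ∑ nonzero ≡ ℤ.+ card ℤ.- 1ℤ
  ∑-nonzero = begin
    ∑ nonzero                                        ≡⟨ x≡x+1-1 (∑ nonzero) ⟩
    (∑ nonzero ℤ.+ 1ℤ) ℤ.- 1ℤ                        ≡⟨ cong (λ w → (∑ nonzero ℤ.+ w) ℤ.- 1ℤ) (sym (∑-when-≡ 0# (λ _ → 1ℤ))) ⟩
    (∑ nonzero ℤ.+ ∑ (λ x → 𝟙 (x ≟ 0#))) ℤ.- 1ℤ      ≡⟨ cong (ℤ._- 1ℤ) (sym (∑-∙ nonzero _)) ⟩
    ∑ (λ x → nonzero x ℤ.+ 𝟙 (x ≟ 0#)) ℤ.- 1ℤ        ≡⟨ cong (ℤ._- 1ℤ) (trans (∑-cong nonzero+zero≡1) ∑-1) ⟩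
    ℤ.+ card ℤ.- 1ℤ                                  ∎
    where
      open ≡-Reasoning
      x≡x+1-1 : ∀ x → x ≡ (x ℤ.+ 1ℤ) ℤ.- 1ℤ
      x≡x+1-1 = solve-∀
      nonzero+zero≡1 : ∀ x → nonzero x ℤ.+ 𝟙 (x ≟ 0#) ≡ 1ℤ
      nonzero+zero≡1 x with x ≟ 0#
      ... | yes _ = refl
      ... | no _ = refl

  IsNonzeroSquare : Carrier → Set
  IsNonzeroSquare z = ∃ λ y → ¬ y ≡ 0# × y * y ≡ z

  nonzeroSquare : Carrier → ℤ
  nonzeroSquare z = 𝟙 (search _ (λ y → ¬? (y ≟ 0#) ×-dec ((y * y) ≟ z)))

  residueIndicator : Carrier → ℤ
  residueIndicator z = 𝟙 (¬? (z ≟ 0#) ×-dec (χ z ≟ 1#))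

  legendre≡2residue-nonzero : ∀ z → legendre z ≡ (residueIndicator z ℤ.+ residueIndicator z) ℤ.- nonzero z
  legendre≡2residue-nonzero z with legendre-view z
  ... | zero z≡0 λz = trans λz (sym (cong₂ (λ a b → (a ℤ.+ a) ℤ.- b)
          (when-no (¬? (z ≟ 0#) ×-dec (χ z ≟ 1#)) (λ (z≢0 , _) → z≢0 z≡0))
          (when-no (¬? (z ≟ 0#)) (λ z≢0 → z≢0 z≡0))))
  ... | residue z≢0 χz≡1 λz = trans λz (sym (cong₂ (λ a b → (a ℤ.+ a) ℤ.- b)
          (when-yes (¬? (z ≟ 0#) ×-dec (χ z ≟ 1#)) (z≢0 , χz≡1))
          (when-yes (¬? (z ≟ 0#)) z≢0)))
  ... | nonresidue z≢0 χz≡-1 λz = trans λz (sym (cong₂ (λ a b → (a ℤ.+ a) ℤ.- b)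
          (when-no (¬? (z ≟ 0#) ×-dec (χ z ≟ 1#)) (λ (_ , χz≡1) → -1≢1 (trans (sym χz≡-1) χz≡1)))
          (when-yes (¬? (z ≟ 0#)) z≢0)))

  ∑-square-roots : ∀ {y} → ¬ y ≡ 0# → (f : Carrier → ℤ) → ∑ (λ x → when ((x * x) ≟ (y * y)) (f x)) ≡ f y ℤ.+ f (- y)
  ∑-square-roots {y} y≢0 f =
    trans (∑-cong roots) (trans (∑-∙ (λ x → when (x ≟ y) (f y)) (λ x → when (x ≟ (- y)) (f (- y))))
      (cong₂ ℤ._+_ (∑-when-≡ y (λ _ → f y)) (∑-when-≡ (- y) (λ _ → f (- y)))))
    where
      roots : ∀ x → when ((x * x) ≟ (y * y)) (f x) ≡ when (x ≟ y) (f y) ℤ.+ when (x ≟ (- y)) (f (- y))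
      roots x with x ≟ y | x ≟ (- y)
      ... | yes x≡y | yes x≡-y = ⊥-elim (x≢0⇒x≢-x y≢0 (trans (sym x≡y) x≡-y))
      ... | yes refl | no _ = trans (when-yes ((x * x) ≟ (x * x)) refl) (sym (ℤP.+-identityʳ (f x)))
      ... | no _ | yes refl = trans (when-yes ((x * x) ≟ (y * y)) (-x*-x≡x*x y)) (sym (ℤP.+-identityˡ (f x)))
      ... | no x≢y | no x≢-y = when-no ((x * x) ≟ (y * y)) (λ xx≡yy → [ x≢y , x≢-y ]′ (x*x≡y*y⇒x≡±y xx≡yy))

  ∑-square-fiber : ∀ z → ∑ (λ x → when ((x * x) ≟ z) (nonzero x)) ≡ nonzeroSquare z ℤ.+ nonzeroSquare z
  ∑-square-fiber z with search _ (λ y → ¬? (y ≟ 0#) ×-dec ((y * y) ≟ z))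
  ... | yes (y , y≢0 , refl) = trans (∑-square-roots y≢0 nonzero)
          (cong₂ ℤ._+_ (when-yes (¬? (y ≟ 0#)) y≢0) (when-yes (¬? ((- y) ≟ 0#)) (-‿≢0 y≢0)))
  ... | no no-root = trans (∑-cong no-term) ∑-ε
    where
      no-term : ∀ x → when ((x * x) ≟ z) (nonzero x) ≡ 0ℤ
      no-term x with (x * x) ≟ z | x ≟ 0#
      ... | no _ | _ = refl
      ... | yes _ | yes _ = refl
      ... | yes xx≡z | no x≢0 = ⊥-elim (no-root (x , x≢0 , xx≡z))

  -- Both 2 ∑ residueIndicator and 2 ∑ nonzeroSquare count the nonzero elements,
  -- and residueIndicator dominates nonzeroSquare, so the two indicators agree.
  residue≡nonzeroSquare : ∀ z → residueIndicator z ℤ.- nonzeroSquare z ≡ 0ℤ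
  residue≡nonzeroSquare = ∑-nonneg-zero (λ z → residueIndicator z ℤ.- nonzeroSquare z) square⇒residue
    (a+a≡0⇒a≡0 (begin
      ∑ (λ z → u z ℤ.- sq z) ℤ.+ ∑ (λ z → u z ℤ.- sq z)     ≡⟨ sym (∑-∙ (λ z → u z ℤ.- sq z) (λ z → u z ℤ.- sq z)) ⟩
      ∑ (λ z → (u z ℤ.- sq z) ℤ.+ (u z ℤ.- sq z))           ≡⟨ ∑-cong (λ z → regroup (u z) (sq z)) ⟩
      ∑ (λ z → (u z ℤ.+ u z) ℤ.- (sq z ℤ.+ sq z))           ≡⟨ ∑-sub (λ z → u z ℤ.+ u z) (λ z → sq z ℤ.+ sq z) ⟩
      ∑ (λ z → u z ℤ.+ u z) ℤ.- ∑ (λ z → sq z ℤ.+ sq z)     ≡⟨ cong (ℤ._- ∑ (λ z → sq z ℤ.+ sq z)) (trans ∑2u≡∑nonzero ∑nonzero≡∑2sq) ⟩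
      ∑ (λ z → sq z ℤ.+ sq z) ℤ.- ∑ (λ z → sq z ℤ.+ sq z)   ≡⟨ ℤP.+-inverseʳ (∑ (λ z → sq z ℤ.+ sq z)) ⟩
      0ℤ                                                     ∎))
    where
      open ≡-Reasoning
      u = residueIndicator
      sq = nonzeroSquare
      regroup : ∀ a b → (a ℤ.- b) ℤ.+ (a ℤ.- b) ≡ (a ℤ.+ a) ℤ.- (b ℤ.+ b)
      regroup = solve-∀
      a+a≡0⇒a≡0 : ∀ {a} → a ℤ.+ a ≡ 0ℤ → a ≡ 0ℤ
      a+a≡0⇒a≡0 {ℤ.+ zero} _ = refl
      a+a≡0⇒a≡0 {ℤ.+ suc _} ()
      a+a≡0⇒a≡0 {ℤ.-[1+ _ ]} ()
      ∑2u≡∑nonzero : ∑ (λ z → u z ℤ.+ u z) ≡ ∑ nonzero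
      ∑2u≡∑nonzero = ℤP.i-j≡0⇒i≡j _ _ (begin
        ∑ (λ z → u z ℤ.+ u z) ℤ.- ∑ nonzero            ≡⟨ sym (∑-sub (λ z → u z ℤ.+ u z) nonzero) ⟩
        ∑ (λ z → (u z ℤ.+ u z) ℤ.- nonzero z)          ≡⟨ ∑-cong (λ z → sym (legendre≡2residue-nonzero z)) ⟩
        ∑ legendre                                     ≡⟨ ∑-legendre ⟩
        0ℤ                                             ∎)
      ∑nonzero≡∑2sq : ∑ nonzero ≡ ∑ (λ z → sq z ℤ.+ sq z)
      ∑nonzero≡∑2sq = trans (∑-fiber (λ x → x * x) nonzero) (∑-cong ∑-square-fiber)
      square⇒residue : ∀ z → 0ℤ ℤ.≤ u z ℤ.- sq z
      square⇒residue z with search _ (λ y → ¬? (y ≟ 0#) ×-dec ((y * y) ≟ z))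
      ... | no _ = subst (0ℤ ℤ.≤_) (sym (ℤP.+-identityʳ (u z))) (𝟙-nonneg (¬? (z ≟ 0#) ×-dec (χ z ≟ 1#)))
      ... | yes (y , y≢0 , refl) =
        subst (λ w → 0ℤ ℤ.≤ w ℤ.- 1ℤ)
          (sym (when-yes (¬? ((y * y) ≟ 0#) ×-dec (χ (y * y) ≟ 1#))
                         (*-≢0 y≢0 y≢0 , trans (χ-* y y) (χ*χ≡1 y≢0))))
          (ℤ.+≤+ z≤n)

  euler-criterion : ∀ {d} → legendre d ≡ 1ℤ → ∃ λ y → y * y ≡ d
  euler-criterion {d} λd≡1 with legendre-view d
  ... | zero _ λd≡0 = contradiction (trans (sym λd≡0) λd≡1) (λ ())
  ... | nonresidue _ _ λd≡-1 = contradiction (trans (sym λd≡-1) λd≡1) (λ ())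
  ... | residue d≢0 χd≡1 _ with search _ (λ y → ¬? (y ≟ 0#) ×-dec ((y * y) ≟ d)) | residue≡nonzeroSquare d
  ...   | yes (y , _ , yy≡d) | _ = y , yy≡d
  ...   | no _ | 1-0≡0 = contradiction (trans (cong (ℤ._- 0ℤ)
            (sym (when-yes (¬? (d ≟ 0#) ×-dec (χ d ≟ 1#)) (d≢0 , χd≡1)))) 1-0≡0) (λ ())

module JacobiSum (K : FiniteField) (char3 : Characteristic3 K)
                 (e : ℕ) (card≡1+2e : FiniteField.card K ≡ suc (e ℕ.+ e)) (e≥1 : 1 ℕ.≤ e) where
  open QuadraticCharacter K char3 e card≡1+2e e≥1

  legendre-1 : legendre 1# ≡ 1ℤ
  legendre-1 = legendre-residue (λ 1≡0 → 0≢1 (sym 1≡0)) (1^ e)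

  jacobi-sum : ∀ d → ∑ (λ t → legendre t ℤ.* legendre (t + d)) ≡ ℤ.+ card ℤ.* 𝟙 (d ≟ 0#) ℤ.- 1ℤ
  jacobi-sum d with d ≟ 0#
  ... | yes refl = trans (∑-cong diagonal) (trans ∑-nonzero (cong (ℤ._- 1ℤ) (sym (ℤP.*-identityʳ (ℤ.+ card)))))
    where
      diagonal : ∀ t → legendre t ℤ.* legendre (t + 0#) ≡ nonzero t
      diagonal t with legendre-view t
      ... | zero t≡0 λt≡0 = trans (cong (ℤ._* legendre (t + 0#)) λt≡0) (sym (when-no (¬? (t ≟ 0#)) (λ t≢0 → t≢0 t≡0)))
      ... | residue t≢0 _ _ = trans (cong (λ z → legendre t ℤ.* legendre z) (+-identityʳ t))
                                    (trans (legendre*legendre≡1 t≢0) (sym (when-yes (¬? (t ≟ 0#)) t≢0)))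
      ... | nonresidue t≢0 _ _ = trans (cong (λ z → legendre t ℤ.* legendre z) (+-identityʳ t))
                                    (trans (legendre*legendre≡1 t≢0) (sym (when-yes (¬? (t ≟ 0#)) t≢0)))
  ... | no d≢0 = begin
    ∑ (λ t → legendre t ℤ.* legendre (t + d))                ≡⟨ ∑-cong pointwise ⟩
    ∑ (λ t → legendre (φ t) ℤ.- 𝟙 (t ≟ 0#))                  ≡⟨ ∑-sub (λ t → legendre (φ t)) (λ t → 𝟙 (t ≟ 0#)) ⟩
    ∑ (λ t → legendre (φ t)) ℤ.- ∑ (λ t → 𝟙 (t ≟ 0#))        ≡⟨ cong₂ ℤ._-_ (trans (∑-reindex φ ψ ψφ φψ legendre) ∑-legendre)
                                                                             (∑-when-≡ 0# (λ _ → 1ℤ)) ⟩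
    -1ℤ                                                      ≡⟨ cong (ℤ._- 1ℤ) (sym (ℤP.*-zeroʳ (ℤ.+ card))) ⟩
    ℤ.+ card ℤ.* 0ℤ ℤ.- 1ℤ                                   ∎
    where
      open ≡-Reasoning
      -- t (t + d) = t² φ(t) for t ≠ 0, and φ is a permutation of K.
      φ : Carrier → Carrier
      φ t = 1# + d * t ⁻¹
      ψ : Carrier → Carrier
      ψ u = d * (u + - 1#) ⁻¹
      ψφ : ∀ t → ψ (φ t) ≡ t
      ψφ t = begin
        d * ((1# + d * t ⁻¹) + - 1#) ⁻¹   ≡⟨ cong (λ w → d * w ⁻¹) (solve 1 (λ a → ((con 1₃ :+ a) :+ :- con 1₃) := a) refl (d * t ⁻¹)) ⟩
        d * (d * t ⁻¹) ⁻¹                 ≡⟨ cong (d *_) (trans (⁻¹-*-distrib d (t ⁻¹)) (cong (d ⁻¹ *_) (⁻¹-involutive t))) ⟩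
        d * (d ⁻¹ * t)                    ≡⟨ x*[x⁻¹*y]≡y t d≢0 ⟩
        t                                 ∎
      φψ : ∀ u → φ (ψ u) ≡ u
      φψ u = begin
        1# + d * (d * (u + - 1#) ⁻¹) ⁻¹   ≡⟨ cong (λ w → 1# + d * w) (trans (⁻¹-*-distrib d _) (cong (d ⁻¹ *_) (⁻¹-involutive _))) ⟩
        1# + d * (d ⁻¹ * (u + - 1#))      ≡⟨ cong (1# +_) (x*[x⁻¹*y]≡y (u + - 1#) d≢0) ⟩
        1# + (u + - 1#)                   ≡⟨ solve 1 (λ u → (con 1₃ :+ (u :+ :- con 1₃)) := u) refl u ⟩
        u                                 ∎
      pointwise : ∀ t → legendre t ℤ.* legendre (t + d) ≡ legendre (φ t) ℤ.- 𝟙 (t ≟ 0#)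
      pointwise t = by-cases (t ≟ 0#)
       where
       by-cases : (t≟0 : Dec (t ≡ 0#)) → legendre t ℤ.* legendre (t + d) ≡ legendre (φ t) ℤ.- 𝟙 t≟0
       by-cases (yes refl) = begin
        legendre 0# ℤ.* legendre (0# + d)   ≡⟨ cong (ℤ._* legendre (0# + d)) (legendre-0 refl) ⟩
        0ℤ                                  ≡⟨ sym (cong (ℤ._- 1ℤ) legendre-1) ⟩
        legendre 1# ℤ.- 1ℤ                  ≡⟨ sym (cong (λ w → legendre w ℤ.- 1ℤ) φ0≡1) ⟩
        legendre (φ 0#) ℤ.- 1ℤ              ∎
        where
          φ0≡1 : φ 0# ≡ 1#
          φ0≡1 = trans (cong (λ w → 1# + d * w) 0⁻¹≡0) (trans (cong (1# +_) (zeroʳ d)) (+-identityʳ 1#))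
       by-cases (no t≢0) = begin
        legendre t ℤ.* legendre (t + d)     ≡⟨ sym (legendre-* t (t + d)) ⟩
        legendre (t * (t + d))              ≡⟨ cong legendre factor ⟩
        legendre ((t * t) * φ t)            ≡⟨ legendre-square-* (φ t) t≢0 ⟩
        legendre (φ t)                      ≡⟨ sym (ℤP.+-identityʳ _) ⟩
        legendre (φ t) ℤ.- 0ℤ               ∎
        where
          factor : t * (t + d) ≡ (t * t) * φ t
          factor = begin
            t * (t + d)                         ≡⟨ solve 2 (λ t d → (t :* (t :+ d)) := ((t :* t) :+ (t :* d) :* con 1₃)) refl t d ⟩
            t * t + (t * d) * 1#                ≡⟨ cong (λ w → t * t + (t * d) * w) (sym (x*x⁻¹≡1 t≢0)) ⟩
            t * t + (t * d) * (t * t ⁻¹)        ≡⟨ solve 3 (λ t d u → ((t :* t) :+ (t :* d) :* (t :* u)) := ((t :* t) :* (con 1₃ :+ d :* u))) refl t d (t ⁻¹) ⟩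
            (t * t) * (1# + d * t ⁻¹)           ∎

module CubicCharacterSum
  (K : FiniteField) (char3 : Characteristic3 K)
  (e : ℕ) (card≡1+2e : FiniteField.card K ≡ suc (e ℕ.+ e)) (e≥1 : 1 ℕ.≤ e)
  (b : FiniteField.Carrier K) (b≢0 : ¬ b ≡ FiniteField.0# K)
  (legendre-1≡1 : FiniteField.legendre K (FiniteField.-_ K (FiniteField.1# K)) ≡ 1ℤ)
  (s : FiniteField.Carrier K) (s*s≡-b : FiniteField._*_ K s s ≡ FiniteField.-_ K b)
  where
  open QuadraticCharacter K char3 e card≡1+2e e≥1 public
  open JacobiSum K char3 e card≡1+2e e≥1 public

  g : Carrier → Carrier
  g x = (x ^ 3) + (b * x)

  σ : Carrier → ℤ
  σ t = ∑ (λ x → legendre (g x + t))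

  Q : ℤ
  Q = ℤ.+ card

  -- In characteristic 3, cubing is additive.
  g-+ : ∀ x y → g (x + y) ≡ g x + g y
  g-+ x y = solve 3 (λ x y b → ((x :+ y) :* ((x :+ y) :* ((x :+ y) :* con 1₃)) :+ b :* (x :+ y))
                             := ((x :* (x :* (x :* con 1₃)) :+ b :* x) :+ (y :* (y :* (y :* con 1₃)) :+ b :* y)))
                    refl x y b

  g-neg : ∀ x → g (- x) ≡ - g x
  g-neg x = solve 2 (λ x b → ((:- x) :* ((:- x) :* ((:- x) :* con 1₃)) :+ b :* (:- x))
                         := (:- (x :* (x :* (x :* con 1₃)) :+ b :* x))) refl x b

  g≡x[x²+b] : ∀ x → g x ≡ x * (x * x + b)
  g≡x[x²+b] x = solve 2 (λ x b → (x :* (x :* (x :* con 1₃)) :+ b :* x) := (x :* (x :* x :+ b))) refl x b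

  g0≡0 : g 0# ≡ 0#
  g0≡0 = trans (g≡x[x²+b] 0#) (zeroˡ _)

  s≢0 : ¬ s ≡ 0#
  s≢0 refl = b≢0 (trans (sym (-‿involutive b)) (trans (cong -_ (trans (sym s*s≡-b) (zeroˡ 0#))) -0#≈0#))

  gs≡0 : g s ≡ 0#
  gs≡0 = trans (g≡x[x²+b] s) (trans (cong (λ w → s * (w + b)) s*s≡-b) (trans (cong (s *_) (-‿inverseˡ b)) (zeroʳ s)))

  g-s≡0 : g (- s) ≡ 0#
  g-s≡0 = trans (g-neg s) (trans (cong -_ gs≡0) -0#≈0#)

  kernel : ∀ {x} → g x ≡ 0# → x ≡ 0# ⊎ x ≡ s ⊎ x ≡ - s
  kernel {x} gx≡0 with x*y≡0⇒x≡0∨y≡0 (trans (sym (g≡x[x²+b] x)) gx≡0)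
  ... | inj₁ x≡0 = inj₁ x≡0
  ... | inj₂ x²+b≡0 = inj₂ (x*x≡y*y⇒x≡±y (trans (+-inverseˡ-unique (x * x) b x²+b≡0) (sym s*s≡-b)))

  ∑-kernel : ∑ (λ x → 𝟙 (g x ≟ 0#)) ≡ ℤ.+ 3
  ∑-kernel = begin
    ∑ (λ x → 𝟙 (g x ≟ 0#))                                            ≡⟨ ∑-cong indicator ⟩
    ∑ (λ x → 𝟙 (x ≟ 0#) ℤ.+ (𝟙 (x ≟ s) ℤ.+ 𝟙 (x ≟ (- s))))            ≡⟨ ∑-∙ (λ x → 𝟙 (x ≟ 0#)) (λ x → 𝟙 (x ≟ s) ℤ.+ 𝟙 (x ≟ (- s))) ⟩
    ∑ (λ x → 𝟙 (x ≟ 0#)) ℤ.+ ∑ (λ x → 𝟙 (x ≟ s) ℤ.+ 𝟙 (x ≟ (- s)))  ≡⟨ cong₂ ℤ._+_ (∑-when-≡ 0# (λ _ → 1ℤ))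
                                                                          (trans (∑-∙ (λ x → 𝟙 (x ≟ s)) (λ x → 𝟙 (x ≟ (- s))))
                                                                                 (cong₂ ℤ._+_ (∑-when-≡ s (λ _ → 1ℤ)) (∑-when-≡ (- s) (λ _ → 1ℤ)))) ⟩
    ℤ.+ 3                                                             ∎
    where
      open ≡-Reasoning
      s≢-s : ¬ s ≡ - s
      s≢-s = x≢0⇒x≢-x s≢0
      indicator : ∀ x → 𝟙 (g x ≟ 0#) ≡ 𝟙 (x ≟ 0#) ℤ.+ (𝟙 (x ≟ s) ℤ.+ 𝟙 (x ≟ (- s)))
      indicator x with x ≟ 0# | x ≟ s | x ≟ (- s)
      ... | yes refl | yes s≡0 | _ = ⊥-elim (s≢0 (sym s≡0))
      ... | yes refl | _ | yes 0≡-s = ⊥-elim (-‿≢0 s≢0 (sym 0≡-s))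
      ... | _ | yes refl | yes s≡-s = ⊥-elim (s≢-s s≡-s)
      ... | yes refl | no _ | no _ = when-yes (g 0# ≟ 0#) g0≡0
      ... | no _ | yes refl | no _ = when-yes (g s ≟ 0#) gs≡0
      ... | no _ | no _ | yes refl = when-yes (g (- s) ≟ 0#) g-s≡0
      ... | no x≢0 | no x≢s | no x≢-s = when-no (g x ≟ 0#) (λ gx≡0 → [ x≢0 , [ x≢s , x≢-s ]′ ]′ (kernel gx≡0))

  ∑-fiber-g : ∀ u → ∑ (λ y → 𝟙 (g y ≟ g u)) ≡ ℤ.+ 3
  ∑-fiber-g u = trans (sym (∑-translate u (λ y → 𝟙 (g y ≟ g u))))
                      (trans (∑-cong (λ y → when-cong (g (y + u) ≟ g u) (g y ≟ 0#) shifted unshifted refl)) ∑-kernel)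
    where
      shifted : ∀ {y} → g (y + u) ≡ g u → g y ≡ 0#
      shifted {y} e = +-identityˡ-unique (g y) (g u) (trans (sym (g-+ y u)) e)
      unshifted : ∀ {y} → g y ≡ 0# → g (y + u) ≡ g u
      unshifted {y} gy≡0 = trans (g-+ y u) (trans (cong (_+ g u) gy≡0) (+-identityˡ _))

  Im : Carrier → Set
  Im t = ∃ λ x → g x ≡ t

  Im? : ∀ t → Dec (Im t)
  Im? t = search (λ x → g x ≡ t) (λ x → g x ≟ t)

  Im-sub : ∀ {a c} → Im a → Im c → Im (a + - c)
  Im-sub (x , refl) (y , refl) = x + - y , trans (g-+ x (- y)) (cong (g x +_) (g-neg y))

  Im-neg : ∀ {a} → Im a → Im (- a)
  Im-neg (x , refl) = - x , g-neg x

  σ-translate : ∀ t u → σ (t + g u) ≡ σ t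
  σ-translate t u = trans (∑-cong shift) (∑-translate u (λ x → legendre (g x + t)))
    where
      shift : ∀ x → legendre (g x + (t + g u)) ≡ legendre (g (x + u) + t)
      shift x = cong legendre (trans (solve 3 (λ a c d → (a :+ (c :+ d)) := ((a :+ d) :+ c)) refl (g x) t (g u))
                                     (cong (_+ t) (sym (g-+ x u))))

  legendre-neg : ∀ y → legendre (- y) ≡ legendre y
  legendre-neg y = begin
    legendre (- y)                   ≡⟨ cong legendre (sym (-1*x≈-x y)) ⟩
    legendre (- 1# * y)              ≡⟨ legendre-* (- 1#) y ⟩
    legendre (- 1#) ℤ.* legendre y   ≡⟨ cong (ℤ._* legendre y) legendre-1≡1 ⟩
    1ℤ ℤ.* legendre y                ≡⟨ ℤP.*-identityˡ _ ⟩
    legendre y                       ∎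
    where open ≡-Reasoning

  σ-neg : ∀ t → σ (- t) ≡ σ t
  σ-neg t = trans (∑-cong reflect) (∑-reindex -_ -_ -‿involutive -‿involutive (λ x → legendre (g x + t)))
    where
      reflect : ∀ x → legendre (g x + - t) ≡ legendre (g (- x) + t)
      reflect x = trans (sym (legendre-neg _))
        (cong legendre (trans (solve 2 (λ a c → (:- (a :+ :- c)) := ((:- a) :+ c)) refl (g x) t)
                              (cong (_+ t) (sym (g-neg x)))))

  σ-image : ∀ {t} → Im t → σ t ≡ σ 0#
  σ-image (u , refl) = trans (cong σ (sym (+-identityˡ (g u)))) (σ-translate 0# u)

  ∑σ≡0 : ∑ σ ≡ 0ℤ
  ∑σ≡0 = begin
    ∑ (λ t → ∑ (λ x → legendre (g x + t)))   ≡⟨ ∑-swap (λ t x → legendre (g x + t)) ⟩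
    ∑ (λ x → ∑ (λ t → legendre (g x + t)))   ≡⟨ ∑-cong (λ x → trans (∑-cong (λ t → cong legendre (+-comm (g x) t)))
                                                                     (trans (∑-translate (g x) legendre) ∑-legendre)) ⟩
    ∑ (λ _ → 0ℤ)                             ≡⟨ ∑-ε ⟩
    0ℤ                                       ∎
    where open ≡-Reasoning

  correlation : ∀ x y → ∑ (λ t → legendre (g x + t) ℤ.* legendre (g y + t)) ≡ Q ℤ.* 𝟙 ((g y + - g x) ≟ 0#) ℤ.- 1ℤ
  correlation x y = trans (sym (∑-translate (- g x) (λ t → legendre (g x + t) ℤ.* legendre (g y + t)))) (trans (∑-cong recentre) (jacobi-sum (g y + - g x)))
    where
      recentre : ∀ t → legendre (g x + (t + - g x)) ℤ.* legendre (g y + (t + - g x))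
                     ≡ legendre t ℤ.* legendre (t + (g y + - g x))
      recentre t = cong₂ ℤ._*_ (cong legendre (solve 2 (λ a t → (a :+ (t :+ :- a)) := t) refl (g x) t))
                               (cong legendre (solve 3 (λ c t a → (c :+ (t :+ :- a)) := (t :+ (c :+ :- a))) refl (g y) t (g x)))

  ∑σ²≡2Q² : ∑ (λ t → σ t ℤ.* σ t) ≡ ℤ.+ 2 ℤ.* (Q ℤ.* Q)
  ∑σ²≡2Q² = begin
    ∑ (λ t → σ t ℤ.* σ t)                                ≡⟨ ∑-cong (λ t → ∑-*-∑ (λ x → L x t) (λ y → L y t)) ⟩
    ∑ (λ t → ∑ (λ x → ∑ (λ y → L x t ℤ.* L y t)))        ≡⟨ ∑-swap (λ t x → ∑ (λ y → L x t ℤ.* L y t)) ⟩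
    ∑ (λ x → ∑ (λ t → ∑ (λ y → L x t ℤ.* L y t)))        ≡⟨ ∑-cong (λ x → ∑-swap (λ t y → L x t ℤ.* L y t)) ⟩
    ∑ (λ x → ∑ (λ y → ∑ (λ t → L x t ℤ.* L y t)))        ≡⟨ ∑-cong (λ x → ∑-cong (correlation x)) ⟩
    ∑ (λ x → ∑ (λ y → Q ℤ.* 𝟙 ((g y + - g x) ≟ 0#) ℤ.- 1ℤ)) ≡⟨ ∑-cong row ⟩
    ∑ (λ x → Q ℤ.* ℤ.+ 3 ℤ.- Q)                          ≡⟨ ∑-const (Q ℤ.* ℤ.+ 3 ℤ.- Q) ⟩
    (Q ℤ.* ℤ.+ 3 ℤ.- Q) ℤ.* Q                            ≡⟨ [3Q-Q]Q≡2QQ Q ⟩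
    ℤ.+ 2 ℤ.* (Q ℤ.* Q)                                  ∎
    where
      open ≡-Reasoning
      L : Carrier → Carrier → ℤ
      L x t = legendre (g x + t)
      [3Q-Q]Q≡2QQ : ∀ q → (q ℤ.* ℤ.+ 3 ℤ.- q) ℤ.* q ≡ ℤ.+ 2 ℤ.* (q ℤ.* q)
      [3Q-Q]Q≡2QQ = solve-∀
      row : ∀ x → ∑ (λ y → Q ℤ.* 𝟙 ((g y + - g x) ≟ 0#) ℤ.- 1ℤ) ≡ Q ℤ.* ℤ.+ 3 ℤ.- Q
      row x = begin
        ∑ (λ y → Q ℤ.* 𝟙 ((g y + - g x) ≟ 0#) ℤ.- 1ℤ)           ≡⟨ ∑-sub (λ y → Q ℤ.* 𝟙 ((g y + - g x) ≟ 0#)) (λ _ → 1ℤ) ⟩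
        ∑ (λ y → Q ℤ.* 𝟙 ((g y + - g x) ≟ 0#)) ℤ.- ∑ (λ _ → 1ℤ) ≡⟨ cong₂ ℤ._-_ (trans (∑-*ˡ Q _) (cong (Q ℤ.*_) same-fiber)) ∑-1 ⟩
        Q ℤ.* ℤ.+ 3 ℤ.- Q                                        ∎
        where
          same-fiber : ∑ (λ y → 𝟙 ((g y + - g x) ≟ 0#)) ≡ ℤ.+ 3
          same-fiber = trans (∑-cong (λ y → when-cong ((g y + - g x) ≟ 0#) (g y ≟ g x) x-y≡0⇒x≡y
                                                     (λ gy≡gx → trans (cong (_+ - g x) gy≡gx) (-‿inverseʳ (g x))) refl))
                             (∑-fiber-g x)

  imageSize : ℤ
  imageSize = ∑ (λ t → 𝟙 (Im? t))

  Q≡3·imageSize : Q ≡ ℤ.+ 3 ℤ.* imageSize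
  Q≡3·imageSize = begin
    Q                                                ≡⟨ sym ∑-1 ⟩
    ∑ (λ _ → 1ℤ)                                     ≡⟨ ∑-fiber g (λ _ → 1ℤ) ⟩
    ∑ (λ t → ∑ (λ x → 𝟙 (g x ≟ t)))                  ≡⟨ ∑-cong fiber ⟩
    ∑ (λ t → ℤ.+ 3 ℤ.* 𝟙 (Im? t))                    ≡⟨ ∑-*ˡ (ℤ.+ 3) (λ t → 𝟙 (Im? t)) ⟩
    ℤ.+ 3 ℤ.* imageSize                              ∎
    where
      open ≡-Reasoning
      fiber : ∀ t → ∑ (λ x → 𝟙 (g x ≟ t)) ≡ ℤ.+ 3 ℤ.* 𝟙 (Im? t)
      fiber t with Im? t
      ... | yes (u , refl) = trans (∑-fiber-g u) (sym (ℤP.*-identityʳ (ℤ.+ 3)))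
      ... | no ¬Im = trans (∑-cong (λ x → when-no (g x ≟ t) (λ gx≡t → ¬Im (x , gx≡t)))) ∑-ε

  Q≢0 : ¬ Q ≡ 0ℤ
  Q≢0 Q≡0 with trans (sym (cong ℤ.+_ card≡1+2e)) Q≡0
  ... | ()

  imageSize≢0 : ¬ imageSize ≡ 0ℤ
  imageSize≢0 V≡0 = Q≢0 (trans Q≡3·imageSize (trans (cong (ℤ.+ 3 ℤ.*_) V≡0) (ℤP.*-zeroʳ (ℤ.+ 3))))

  -- Im has a third of the elements of K, so it is not all of K.
  ∃∉Im : ∃ λ τ → ¬ Im τ
  ∃∉Im with search (λ t → ¬ Im t) (λ t → ¬? (Im? t))
  ... | yes found = found
  ... | no none = ⊥-elim (imageSize≢0 (V≡3V⇒V≡0 (trans (sym everything) Q≡3·imageSize)))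
    where
      everything : Q ≡ imageSize
      everything = trans (sym ∑-1) (∑-cong (λ t → sym (when-yes (Im? t) (decidable-stable (Im? t) (λ ¬Im → none (t , ¬Im))))))
      V≡3V⇒V≡0 : ∀ {v} → v ≡ ℤ.+ 3 ℤ.* v → v ≡ 0ℤ
      V≡3V⇒V≡0 {v} v≡3v with ℤP.i*j≡0⇒i≡0∨j≡0 (ℤ.+ 2) (trans (2v≡3v-v v) (trans (cong (ℤ._- v) (sym v≡3v)) (ℤP.+-inverseʳ v)))
        where
          2v≡3v-v : ∀ v → ℤ.+ 2 ℤ.* v ≡ ℤ.+ 3 ℤ.* v ℤ.- v
          2v≡3v-v = solve-∀
      ... | inj₁ ()
      ... | inj₂ v≡0 = v≡0

  τ : Carrier
  τ = proj₁ ∃∉Im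

  cosetCount : Carrier → ℤ
  cosetCount t = 𝟙 (Im? t) ℤ.+ 𝟙 (Im? (t + - τ)) ℤ.+ 𝟙 (Im? (t + τ))

  cosetCount≤1 : ∀ t → 0ℤ ℤ.≤ 1ℤ ℤ.- cosetCount t
  cosetCount≤1 t with Im? t | Im? (t + - τ) | Im? (t + τ)
  ... | no _ | no _ | no _ = ℤ.+≤+ z≤n
  ... | yes _ | no _ | no _ = ℤ.+≤+ z≤n
  ... | no _ | yes _ | no _ = ℤ.+≤+ z≤n
  ... | no _ | no _ | yes _ = ℤ.+≤+ z≤n
  ... | yes a | yes c | _ =
    ⊥-elim (proj₂ ∃∉Im (subst Im (solve 2 (λ t u → (t :+ :- (t :+ :- u)) := u) refl t τ) (Im-sub a c)))
  ... | yes a | no _ | yes c =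
    ⊥-elim (proj₂ ∃∉Im (subst Im (solve 2 (λ t u → ((t :+ u) :+ :- t) := u) refl t τ) (Im-sub c a)))
  ... | no _ | yes a | yes c =
    ⊥-elim (proj₂ ∃∉Im (subst Im (solve 2 (λ t u → (:- ((t :+ u) :+ :- (t :+ :- u))) := u) refl t τ) (Im-neg (Im-sub c a))))

  -- The cosets Im, τ + Im and -τ + Im are disjoint and together have 3 · imageSize = |K| elements.
  cosetCount≡1 : ∀ t → cosetCount t ≡ 1ℤ
  cosetCount≡1 t = sym (ℤP.i-j≡0⇒i≡j _ _ (∑-nonneg-zero (λ t → 1ℤ ℤ.- cosetCount t) cosetCount≤1 ∑[1-count]≡0 t))
    where
      open ≡-Reasoning
      v+v+v≡3v : ∀ v → v ℤ.+ v ℤ.+ v ≡ ℤ.+ 3 ℤ.* v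
      v+v+v≡3v = solve-∀
      ∑-count : ∑ cosetCount ≡ Q
      ∑-count = begin
        ∑ cosetCount                                                          ≡⟨ ∑-∙ (λ t → 𝟙 (Im? t) ℤ.+ 𝟙 (Im? (t + - τ))) (λ t → 𝟙 (Im? (t + τ))) ⟩
        ∑ (λ t → 𝟙 (Im? t) ℤ.+ 𝟙 (Im? (t + - τ))) ℤ.+ ∑ (λ t → 𝟙 (Im? (t + τ))) ≡⟨ cong₂ ℤ._+_ (trans (∑-∙ (λ t → 𝟙 (Im? t)) (λ t → 𝟙 (Im? (t + - τ))))
                                                                                        (cong (ℤ._+_ imageSize) (∑-translate (- τ) (λ t → 𝟙 (Im? t)))))
                                                                                 (∑-translate τ (λ t → 𝟙 (Im? t))) ⟩
        imageSize ℤ.+ imageSize ℤ.+ imageSize                                 ≡⟨ trans (v+v+v≡3v imageSize) (sym Q≡3·imageSize) ⟩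
        Q                                                                     ∎
      ∑[1-count]≡0 : ∑ (λ t → 1ℤ ℤ.- cosetCount t) ≡ 0ℤ
      ∑[1-count]≡0 = begin
        ∑ (λ t → 1ℤ ℤ.- cosetCount t)            ≡⟨ ∑-sub (λ _ → 1ℤ) cosetCount ⟩
        ∑ (λ _ → 1ℤ) ℤ.- ∑ cosetCount            ≡⟨ cong₂ ℤ._-_ ∑-1 ∑-count ⟩
        Q ℤ.- Q                                  ≡⟨ ℤP.+-inverseʳ Q ⟩
        0ℤ                                       ∎

  ∉Im⇒Im-τ⊎Im+τ : ∀ {t} → ¬ Im t → Im (t + - τ) ⊎ Im (t + τ)
  ∉Im⇒Im-τ⊎Im+τ {t} ¬Im = by-cases (Im? (t + - τ)) (Im? (t + τ))
    where
      by-cases : Dec (Im (t + - τ)) → Dec (Im (t + τ)) → Im (t + - τ) ⊎ Im (t + τ)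
      by-cases (yes Im-τ) _ = inj₁ Im-τ
      by-cases (no _) (yes Im+τ) = inj₂ Im+τ
      by-cases (no ¬Im-τ) (no ¬Im+τ) = contradiction (begin
        0ℤ ℤ.+ 0ℤ ℤ.+ 0ℤ    ≡⟨ sym (cong₂ ℤ._+_ (cong₂ ℤ._+_ (when-no (Im? t) ¬Im) (when-no (Im? (t + - τ)) ¬Im-τ))
                                                  (when-no (Im? (t + τ)) ¬Im+τ)) ⟩
        cosetCount t        ≡⟨ cosetCount≡1 t ⟩
        1ℤ                  ∎) (λ ())
        where open ≡-Reasoning

  σ-off-image : ∀ {t} → ¬ Im t → σ t ≡ σ τ
  σ-off-image {t} ¬Im with ∉Im⇒Im-τ⊎Im+τ ¬Im
  ... | inj₁ (u , gu≡t-τ) = trans (cong σ (trans (solve 2 (λ t c → t := ((t :+ :- c) :+ c)) refl t τ)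
                                                  (trans (cong (_+ τ) (sym gu≡t-τ)) (+-comm (g u) τ))))
                                  (σ-translate τ u)
  ... | inj₂ (u , gu≡t+τ) = trans (cong σ (trans (solve 2 (λ t c → t := ((t :+ c) :+ :- c)) refl t τ)
                                                  (trans (cong (_+ - τ) (sym gu≡t+τ)) (+-comm (g u) (- τ)))))
                                  (trans (σ-translate (- τ) u) (σ-neg τ))

  ∑-image-split : (f : Carrier → ℤ) {a c : ℤ} → (∀ {t} → Im t → f t ≡ a) → (∀ {t} → ¬ Im t → f t ≡ c) →
    ∑ f ≡ imageSize ℤ.* (a ℤ.+ ℤ.+ 2 ℤ.* c)
  ∑-image-split f {a} {c} on off = begin
    ∑ f                                                              ≡⟨ ∑-cong split ⟩
    ∑ (λ t → 𝟙 (Im? t) ℤ.* a ℤ.+ (1ℤ ℤ.- 𝟙 (Im? t)) ℤ.* c)           ≡⟨ ∑-∙ (λ t → 𝟙 (Im? t) ℤ.* a) (λ t → (1ℤ ℤ.- 𝟙 (Im? t)) ℤ.* c) ⟩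
    ∑ (λ t → 𝟙 (Im? t) ℤ.* a) ℤ.+ ∑ (λ t → (1ℤ ℤ.- 𝟙 (Im? t)) ℤ.* c) ≡⟨ cong₂ ℤ._+_ (∑-*ʳ a (λ t → 𝟙 (Im? t)))
                                                                         (trans (∑-*ʳ c (λ t → 1ℤ ℤ.- 𝟙 (Im? t)))
                                                                                (cong (ℤ._* c) (trans (∑-sub (λ _ → 1ℤ) (λ t → 𝟙 (Im? t))) (cong (ℤ._- imageSize) ∑-1)))) ⟩
    imageSize ℤ.* a ℤ.+ (Q ℤ.- imageSize) ℤ.* c                      ≡⟨ cong (λ q → imageSize ℤ.* a ℤ.+ (q ℤ.- imageSize) ℤ.* c) Q≡3·imageSize ⟩
    imageSize ℤ.* a ℤ.+ (ℤ.+ 3 ℤ.* imageSize ℤ.- imageSize) ℤ.* c    ≡⟨ collect imageSize a c ⟩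
    imageSize ℤ.* (a ℤ.+ ℤ.+ 2 ℤ.* c)                                ∎
    where
      open ≡-Reasoning
      collect : ∀ v a c → v ℤ.* a ℤ.+ (ℤ.+ 3 ℤ.* v ℤ.- v) ℤ.* c ≡ v ℤ.* (a ℤ.+ ℤ.+ 2 ℤ.* c)
      collect = solve-∀
      on-value : ∀ a c → a ≡ 1ℤ ℤ.* a ℤ.+ (1ℤ ℤ.- 1ℤ) ℤ.* c
      on-value = solve-∀
      off-value : ∀ a c → c ≡ 0ℤ ℤ.* a ℤ.+ (1ℤ ℤ.- 0ℤ) ℤ.* c
      off-value = solve-∀
      split : ∀ t → f t ≡ 𝟙 (Im? t) ℤ.* a ℤ.+ (1ℤ ℤ.- 𝟙 (Im? t)) ℤ.* c
      split t = by-cases (Im? t)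
        where
          by-cases : (d : Dec (Im t)) → f t ≡ 𝟙 d ℤ.* a ℤ.+ (1ℤ ℤ.- 𝟙 d) ℤ.* c
          by-cases (yes Im-t) = trans (on Im-t) (on-value a c)
          by-cases (no ¬Im-t) = trans (off ¬Im-t) (off-value a c)

  A B : ℤ
  A = σ 0#
  B = σ τ

  A≡-2B : A ≡ ℤ.- ℤ.+ 2 ℤ.* B
  A≡-2B = a+2c≡0⇒a≡-2c (ℤP.*-cancelˡ-≡ imageSize (A ℤ.+ ℤ.+ 2 ℤ.* B) 0ℤ {{ℤ.≢-nonZero imageSize≢0}}
            (trans (sym (∑-image-split σ σ-image σ-off-image)) (trans ∑σ≡0 (sym (ℤP.*-zeroʳ imageSize)))))
    where
      a≡a+2c+[-2]c : ∀ a c → a ≡ (a ℤ.+ ℤ.+ 2 ℤ.* c) ℤ.+ ℤ.- ℤ.+ 2 ℤ.* c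
      a≡a+2c+[-2]c = solve-∀
      a+2c≡0⇒a≡-2c : ∀ {a c} → a ℤ.+ ℤ.+ 2 ℤ.* c ≡ 0ℤ → a ≡ ℤ.- ℤ.+ 2 ℤ.* c
      a+2c≡0⇒a≡-2c {a} {c} a+2c≡0 = trans (a≡a+2c+[-2]c a c) (trans (cong (ℤ._+ ℤ.- ℤ.+ 2 ℤ.* c) a+2c≡0) (ℤP.+-identityˡ _))

  -- Using A = -2B, the two moments give imageSize · 6B² = 2Q² = imageSize · 6Q.
  B²≡Q : B ℤ.* B ≡ Q
  B²≡Q = ℤP.*-cancelˡ-≡ (ℤ.+ 6 ℤ.* imageSize) (B ℤ.* B) Q {{ℤ.≢-nonZero 6V≢0}} (begin
    ℤ.+ 6 ℤ.* imageSize ℤ.* (B ℤ.* B)                           ≡⟨ second-moment-form imageSize B ⟩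
    imageSize ℤ.* ((ℤ.- ℤ.+ 2 ℤ.* B) ℤ.* (ℤ.- ℤ.+ 2 ℤ.* B) ℤ.+ ℤ.+ 2 ℤ.* (B ℤ.* B)) ≡⟨ cong (λ a → imageSize ℤ.* (a ℤ.* a ℤ.+ ℤ.+ 2 ℤ.* (B ℤ.* B))) (sym A≡-2B) ⟩
    imageSize ℤ.* (A ℤ.* A ℤ.+ ℤ.+ 2 ℤ.* (B ℤ.* B))             ≡⟨ sym (∑-image-split (λ t → σ t ℤ.* σ t) (λ Im-t → cong (λ w → w ℤ.* w) (σ-image Im-t))
                                                                                           (λ ¬Im-t → cong (λ w → w ℤ.* w) (σ-off-image ¬Im-t))) ⟩
    ∑ (λ t → σ t ℤ.* σ t)                                       ≡⟨ ∑σ²≡2Q² ⟩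
    ℤ.+ 2 ℤ.* (Q ℤ.* Q)                                         ≡⟨ cong (λ q → ℤ.+ 2 ℤ.* (q ℤ.* Q)) Q≡3·imageSize ⟩
    ℤ.+ 2 ℤ.* (ℤ.+ 3 ℤ.* imageSize ℤ.* Q)                       ≡⟨ regroup imageSize Q ⟩
    ℤ.+ 6 ℤ.* imageSize ℤ.* Q                                   ∎)
    where
      open ≡-Reasoning
      second-moment-form : ∀ v b → ℤ.+ 6 ℤ.* v ℤ.* (b ℤ.* b) ≡ v ℤ.* ((ℤ.- ℤ.+ 2 ℤ.* b) ℤ.* (ℤ.- ℤ.+ 2 ℤ.* b) ℤ.+ ℤ.+ 2 ℤ.* (b ℤ.* b))
      second-moment-form = solve-∀
      regroup : ∀ v q → ℤ.+ 2 ℤ.* (ℤ.+ 3 ℤ.* v ℤ.* q) ≡ ℤ.+ 6 ℤ.* v ℤ.* q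
      regroup = solve-∀
      6V≢0 : ¬ ℤ.+ 6 ℤ.* imageSize ≡ 0ℤ
      6V≢0 6V≡0 with ℤP.i*j≡0⇒i≡0∨j≡0 (ℤ.+ 6) 6V≡0
      ... | inj₁ ()
      ... | inj₂ V≡0 = imageSize≢0 V≡0

module CubicSumModulo8
  (K : FiniteField) (char3 : Characteristic3 K)
  (e : ℕ) (card≡1+2e : FiniteField.card K ≡ suc (e ℕ.+ e)) (e≥1 : 1 ℕ.≤ e)
  (b : FiniteField.Carrier K) (b≢0 : ¬ b ≡ FiniteField.0# K)
  (legendre-1≡1 : FiniteField.legendre K (FiniteField.-_ K (FiniteField.1# K)) ≡ 1ℤ)
  (s : FiniteField.Carrier K) (s*s≡-b : FiniteField._*_ K s s ≡ FiniteField.-_ K b)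
  (r : FiniteField.Carrier K) (r*r≡b : FiniteField._*_ K r r ≡ b)
  where
  open CubicCharacterSum K char3 e card≡1+2e e≥1 b b≢0 legendre-1≡1 s s*s≡-b

  r≢0 : ¬ r ≡ 0#
  r≢0 refl = b≢0 (trans (sym r*r≡b) (zeroˡ 0#))

  δ : Carrier → ℤ
  δ x = 𝟙 (legendre (g x) ℤ.≟ -1ℤ)

  δ-kernel : ∀ {x} → g x ≡ 0# → δ x ≡ 0ℤ
  δ-kernel {x} gx≡0 =
    when-no (legendre (g x) ℤ.≟ -1ℤ) (λ λgx≡-1 → contradiction (trans (sym (legendre-0 gx≡0)) λgx≡-1) (λ ()))

  δ-neg : ∀ x → δ (- x) ≡ δ x
  δ-neg x = when-cong (legendre (g (- x)) ℤ.≟ -1ℤ) (legendre (g x) ℤ.≟ -1ℤ)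
            (trans (sym λg-x≡λgx)) (trans λg-x≡λgx) refl
    where
      λg-x≡λgx : legendre (g (- x)) ≡ legendre (g x)
      λg-x≡λgx = trans (cong legendre (g-neg x)) (legendre-neg (g x))

  legendre-g : ∀ x → legendre (g x + 0#) ≡ (1ℤ ℤ.- 𝟙 (g x ≟ 0#)) ℤ.- ℤ.+ 2 ℤ.* δ x
  legendre-g x rewrite +-identityʳ (g x) with legendre-view (g x)
  ... | zero gx≡0 λgx≡0 = trans λgx≡0 (sym (cong₂ (λ a c → (1ℤ ℤ.- a) ℤ.- ℤ.+ 2 ℤ.* c)
                             (when-yes (g x ≟ 0#) gx≡0) (δ-kernel gx≡0)))
  ... | residue gx≢0 _ λgx≡1 = trans λgx≡1 (sym (cong₂ (λ a c → (1ℤ ℤ.- a) ℤ.- ℤ.+ 2 ℤ.* c)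
                             (when-no (g x ≟ 0#) gx≢0)
                             (when-no (legendre (g x) ℤ.≟ -1ℤ) (λ λgx≡-1 → contradiction (trans (sym λgx≡1) λgx≡-1) (λ ())))))
  ... | nonresidue gx≢0 _ λgx≡-1 = trans λgx≡-1 (sym (cong₂ (λ a c → (1ℤ ℤ.- a) ℤ.- ℤ.+ 2 ℤ.* c)
                             (when-no (g x ≟ 0#) gx≢0) (when-yes (legendre (g x) ℤ.≟ -1ℤ) λgx≡-1)))

  A≡Q-3-2∑δ : A ≡ (Q ℤ.- ℤ.+ 3) ℤ.- ℤ.+ 2 ℤ.* ∑ δ
  A≡Q-3-2∑δ = begin
    ∑ (λ x → legendre (g x + 0#))                                               ≡⟨ ∑-cong legendre-g ⟩
    ∑ (λ x → (1ℤ ℤ.- 𝟙 (g x ≟ 0#)) ℤ.- ℤ.+ 2 ℤ.* δ x)                          ≡⟨ ∑-sub (λ x → 1ℤ ℤ.- 𝟙 (g x ≟ 0#)) (λ x → ℤ.+ 2 ℤ.* δ x) ⟩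
    ∑ (λ x → 1ℤ ℤ.- 𝟙 (g x ≟ 0#)) ℤ.- ∑ (λ x → ℤ.+ 2 ℤ.* δ x)                  ≡⟨ cong₂ ℤ._-_ (trans (∑-sub (λ _ → 1ℤ) (λ x → 𝟙 (g x ≟ 0#))) (cong₂ ℤ._-_ ∑-1 ∑-kernel))
                                                                                                (∑-*ˡ (ℤ.+ 2) δ) ⟩
    (Q ℤ.- ℤ.+ 3) ℤ.- ℤ.+ 2 ℤ.* ∑ δ                                             ∎
    where open ≡-Reasoning

  rootTerm : Carrier → Carrier → ℤ
  rootTerm z x = when ((x * x) ≟ z) (δ x)

  Δ : Carrier → ℤ
  Δ z = ∑ (rootTerm z)

  E : Carrier → ℤ
  E z = halfSum -_ (rootTerm z)

  Δ≡2E : ∀ z → Δ z ≡ ℤ.+ 2 ℤ.* E z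
  Δ≡2E z = ∑-involution -_ -‿involutive (rootTerm z) symmetric fixed
    where
      symmetric : ∀ x → rootTerm z (- x) ≡ rootTerm z x
      symmetric x = when-cong (((- x) * (- x)) ≟ z) ((x * x) ≟ z) (trans (sym (-x*-x≡x*x x))) (trans (-x*-x≡x*x x)) (δ-neg x)
      fixed : ∀ x → - x ≡ x → rootTerm z x ≡ 0ℤ
      fixed x -x≡x with x ≟ 0# | (x * x) ≟ z
      ... | yes refl | yes _ = δ-kernel g0≡0
      ... | yes refl | no _ = refl
      ... | no x≢0 | _ = ⊥-elim (x≢0⇒x≢-x x≢0 (sym -x≡x))

  half : ∀ {a c} → ℤ.+ 2 ℤ.* a ≡ ℤ.+ 2 ℤ.* c → a ≡ c
  half {a} {c} = ℤP.*-cancelˡ-≡ (ℤ.+ 2) a c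

  E≡0 : ∀ z → (∀ x → x * x ≡ z → g x ≡ 0#) → E z ≡ 0ℤ
  E≡0 z roots-in-kernel = half (trans (sym (Δ≡2E z)) (trans (trans (∑-cong vanish) ∑-ε) (sym (ℤP.*-zeroʳ (ℤ.+ 2)))))
    where
      vanish : ∀ x → rootTerm z x ≡ 0ℤ
      vanish x with (x * x) ≟ z
      ... | yes xx≡z = δ-kernel (roots-in-kernel x xx≡z)
      ... | no _ = refl

  -- ι x = b / x carries the square roots of z to those of κ z = b² / z and preserves δ,
  -- because g (b / x) = (b / x²)² · g x.
  ι : Carrier → Carrier
  ι x = b * x ⁻¹

  κ : Carrier → Carrier
  κ z = (b * b) * z ⁻¹

  ι-involutive : ∀ x → ι (ι x) ≡ x
  ι-involutive x = trans (cong (b *_) (trans (⁻¹-*-distrib b (x ⁻¹)) (cong (b ⁻¹ *_) (⁻¹-involutive x)))) (x*[x⁻¹*y]≡y x b≢0)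

  κ-involutive : ∀ z → κ (κ z) ≡ z
  κ-involutive z = trans (cong ((b * b) *_) (trans (⁻¹-*-distrib (b * b) (z ⁻¹)) (cong ((b * b) ⁻¹ *_) (⁻¹-involutive z))))
                         (x*[x⁻¹*y]≡y z (*-≢0 b≢0 b≢0))

  ι*ι≡κ[x*x] : ∀ x → ι x * ι x ≡ κ (x * x)
  ι*ι≡κ[x*x] x = trans (*-interchange b (x ⁻¹) b (x ⁻¹)) (cong ((b * b) *_) (sym (⁻¹-*-distrib x x)))

  g∘ι : ∀ {x} → ¬ x ≡ 0# → g (ι x) ≡ ((b * x ⁻¹) * x ⁻¹) * ((b * x ⁻¹) * x ⁻¹) * g x
  g∘ι {x} x≢0 = begin
    g (b * u)                                                       ≡⟨ solve 2 (λ b u → ((b :* u) :* ((b :* u) :* ((b :* u) :* con 1₃)) :+ b :* (b :* u))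
                                                                                       := (b :* b :* u :* (con 1₃ :* con 1₃ :* con 1₃) :+ b :* b :* b :* u :* u :* u :* con 1₃)) refl b u ⟩
    b * b * u * (1# * 1# * 1#) + b * b * b * u * u * u * 1#         ≡⟨ cong (λ w → b * b * u * (w * w * w) + b * b * b * u * u * u * w) (sym (x⁻¹*x≡1 x≢0)) ⟩
    b * b * u * ((u * x) * (u * x) * (u * x)) + b * b * b * u * u * u * (u * x)
                                                                    ≡⟨ solve 3 (λ b u x → (b :* b :* u :* ((u :* x) :* (u :* x) :* (u :* x)) :+ b :* b :* b :* u :* u :* u :* (u :* x))
                                                                                       := ((b :* u) :* u) :* ((b :* u) :* u) :* (x :* (x :* (x :* con 1₃)) :+ b :* x)) refl b u x ⟩
    ((b * u) * u) * ((b * u) * u) * g x                             ∎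
    where
      open ≡-Reasoning
      u = x ⁻¹

  δ∘ι : ∀ x → δ (ι x) ≡ δ x
  δ∘ι x = by-cases (x ≟ 0#)
   where
   by-cases : Dec (x ≡ 0#) → δ (ι x) ≡ δ x
   by-cases (yes refl) = cong δ (trans (cong (b *_) 0⁻¹≡0) (zeroʳ b))
   by-cases (no x≢0) = when-cong (legendre (g (ι x)) ℤ.≟ -1ℤ) (legendre (g x) ℤ.≟ -1ℤ) (trans (sym λ∘g∘ι)) (trans λ∘g∘ι) refl
    where
      λ∘g∘ι : legendre (g (ι x)) ≡ legendre (g x)
      λ∘g∘ι = trans (cong legendre (g∘ι x≢0)) (legendre-square-* (g x) (*-≢0 (*-≢0 b≢0 (⁻¹-≢0 x≢0)) (⁻¹-≢0 x≢0)))

  Δ∘κ : ∀ z → Δ (κ z) ≡ Δ z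
  Δ∘κ z = trans (sym (∑-reindex ι ι ι-involutive ι-involutive (rootTerm (κ z))))
                (∑-cong (λ x → when-cong ((ι x * ι x) ≟ κ z) ((x * x) ≟ z) (cancel x) (uncancel x) (δ∘ι x)))
    where
      cancel : ∀ x → ι x * ι x ≡ κ z → x * x ≡ z
      cancel x e = trans (sym (κ-involutive (x * x))) (trans (cong κ (trans (sym (ι*ι≡κ[x*x] x)) e)) (κ-involutive z))
      uncancel : ∀ x → x * x ≡ z → ι x * ι x ≡ κ z
      uncancel x refl = ι*ι≡κ[x*x] x

  E∘κ : ∀ z → E (κ z) ≡ E z
  E∘κ z = half (trans (sym (Δ≡2E (κ z))) (trans (Δ∘κ z) (Δ≡2E z)))

  κ-fixed : ∀ {z} → κ z ≡ z → z ≡ 0# ⊎ z ≡ b ⊎ z ≡ - b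
  κ-fixed {z} κz≡z = by-cases (z ≟ 0#)
   where
   open ≡-Reasoning
   by-cases : Dec (z ≡ 0#) → z ≡ 0# ⊎ z ≡ b ⊎ z ≡ - b
   by-cases (yes z≡0) = inj₁ z≡0
   by-cases (no z≢0) = inj₂ (x*x≡y*y⇒x≡±y (sym (begin
    b * b                  ≡⟨ sym (*-identityʳ (b * b)) ⟩
    (b * b) * 1#           ≡⟨ cong ((b * b) *_) (sym (x⁻¹*x≡1 z≢0)) ⟩
    (b * b) * (z ⁻¹ * z)   ≡⟨ sym (*-assoc (b * b) (z ⁻¹) z) ⟩
    κ z * z                ≡⟨ cong (_* z) κz≡z ⟩
    z * z                  ∎)))

  E0≡0 : E 0# ≡ 0ℤ
  E0≡0 = E≡0 0# (λ x xx≡0 → [ (λ x≡0 → trans (cong g x≡0) g0≡0) , (λ x≡0 → trans (cong g x≡0) g0≡0) ]′ (x*y≡0⇒x≡0∨y≡0 xx≡0))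

  E-b≡0 : E (- b) ≡ 0ℤ
  E-b≡0 = E≡0 (- b) (λ x xx≡-b → trans (g≡x[x²+b] x) (trans (cong (λ w → x * (w + b)) xx≡-b)
                                                           (trans (cong (x *_) (-‿inverseˡ b)) (zeroʳ x))))

  Eb≡δr : E b ≡ δ r
  Eb≡δr = half (begin
    ℤ.+ 2 ℤ.* E b                       ≡⟨ sym (Δ≡2E b) ⟩
    ∑ (λ x → when ((x * x) ≟ b) (δ x))  ≡⟨ subst (λ z → ∑ (λ x → when ((x * x) ≟ z) (δ x)) ≡ δ r ℤ.+ δ (- r)) r*r≡b (∑-square-roots r≢0 δ) ⟩
    δ r ℤ.+ δ (- r)                     ≡⟨ cong (ℤ._+_ (δ r)) (δ-neg r) ⟩
    δ r ℤ.+ δ r                         ≡⟨ a+a≡2a (δ r) ⟩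
    ℤ.+ 2 ℤ.* δ r                       ∎)
    where
      open ≡-Reasoning
      a+a≡2a : ∀ a → a ℤ.+ a ≡ ℤ.+ 2 ℤ.* a
      a+a≡2a = solve-∀

  -- E away from b; it is κ-invariant and vanishes at the fixed points 0, b, -b of κ.
  E′ : Carrier → ℤ
  E′ z = (1ℤ ℤ.- 𝟙 (z ≟ b)) ℤ.* E z

  ∑E≡δr+2M : ∑ E ≡ δ r ℤ.+ ℤ.+ 2 ℤ.* halfSum κ E′
  ∑E≡δr+2M = begin
    ∑ E                                               ≡⟨ ∑-cong (λ z → split (𝟙 (z ≟ b)) (E z)) ⟩
    ∑ (λ z → 𝟙 (z ≟ b) ℤ.* E z ℤ.+ E′ z)              ≡⟨ ∑-∙ (λ z → 𝟙 (z ≟ b) ℤ.* E z) E′ ⟩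
    ∑ (λ z → 𝟙 (z ≟ b) ℤ.* E z) ℤ.+ ∑ E′              ≡⟨ cong₂ ℤ._+_ (trans (∑-cong (λ z → 𝟙*≡when (z ≟ b) (E z))) (∑-when-≡ b E))
                                                                      (∑-involution κ κ-involutive E′ E′∘κ E′-fixed) ⟩
    E b ℤ.+ ℤ.+ 2 ℤ.* halfSum κ E′                    ≡⟨ cong (ℤ._+ ℤ.+ 2 ℤ.* halfSum κ E′) Eb≡δr ⟩
    δ r ℤ.+ ℤ.+ 2 ℤ.* halfSum κ E′                    ∎
    where
      open ≡-Reasoning
      split : ∀ a c → c ≡ a ℤ.* c ℤ.+ (1ℤ ℤ.- a) ℤ.* c
      split = solve-∀
      𝟙*≡when : ∀ {P : Set} (d : Dec P) c → 𝟙 d ℤ.* c ≡ when d c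
      𝟙*≡when (yes _) c = ℤP.*-identityˡ c
      𝟙*≡when (no _) c = ℤP.*-zeroˡ c
      κb≡b : κ b ≡ b
      κb≡b = trans (*-assoc b b (b ⁻¹)) (trans (cong (b *_) (x*x⁻¹≡1 b≢0)) (*-identityʳ b))
      E′∘κ : ∀ z → E′ (κ z) ≡ E′ z
      E′∘κ z = cong₂ (λ a c → (1ℤ ℤ.- a) ℤ.* c)
        (when-cong (κ z ≟ b) (z ≟ b) (λ κz≡b → trans (sym (κ-involutive z)) (trans (cong κ κz≡b) κb≡b))
                                     (λ z≡b → trans (cong κ z≡b) κb≡b) refl)
        (E∘κ z)
      E′-fixed : ∀ z → κ z ≡ z → E′ z ≡ 0ℤ
      E′-fixed z κz≡z with κ-fixed κz≡z
      ... | inj₁ refl = trans (cong ((1ℤ ℤ.- 𝟙 (0# ≟ b)) ℤ.*_) E0≡0) (ℤP.*-zeroʳ (1ℤ ℤ.- 𝟙 (0# ≟ b)))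
      ... | inj₂ (inj₁ refl) = cong (λ a → (1ℤ ℤ.- a) ℤ.* E b) (when-yes (b ≟ b) refl)
      ... | inj₂ (inj₂ refl) = trans (cong ((1ℤ ℤ.- 𝟙 ((- b) ≟ b)) ℤ.*_) E-b≡0) (ℤP.*-zeroʳ (1ℤ ℤ.- 𝟙 ((- b) ≟ b)))

  ∑δ≡2δr+4M : ∑ δ ≡ ℤ.+ 2 ℤ.* δ r ℤ.+ ℤ.+ 4 ℤ.* halfSum κ E′
  ∑δ≡2δr+4M = begin
    ∑ δ                                        ≡⟨ ∑-fiber (λ x → x * x) δ ⟩
    ∑ Δ                                        ≡⟨ ∑-cong Δ≡2E ⟩
    ∑ (λ z → ℤ.+ 2 ℤ.* E z)                    ≡⟨ ∑-*ˡ (ℤ.+ 2) E ⟩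
    ℤ.+ 2 ℤ.* ∑ E                              ≡⟨ cong (ℤ.+ 2 ℤ.*_) ∑E≡δr+2M ⟩
    ℤ.+ 2 ℤ.* (δ r ℤ.+ ℤ.+ 2 ℤ.* halfSum κ E′) ≡⟨ distribute (δ r) (halfSum κ E′) ⟩
    ℤ.+ 2 ℤ.* δ r ℤ.+ ℤ.+ 4 ℤ.* halfSum κ E′   ∎
    where
      open ≡-Reasoning
      distribute : ∀ a m → ℤ.+ 2 ℤ.* (a ℤ.+ ℤ.+ 2 ℤ.* m) ≡ ℤ.+ 2 ℤ.* a ℤ.+ ℤ.+ 4 ℤ.* m
      distribute = solve-∀

  λ[gr]≡λr : legendre (g r) ≡ legendre r
  λ[gr]≡λr = begin
    legendre (g r)                   ≡⟨ cong legendre (g≡x[x²+b] r) ⟩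
    legendre (r * (r * r + b))       ≡⟨ cong (λ w → legendre (r * (w + b))) r*r≡b ⟩
    legendre (r * (b + b))           ≡⟨ cong (λ w → legendre (r * w)) (solve 1 (λ b → (b :+ b) := (:- b)) refl b) ⟩
    legendre (r * - b)               ≡⟨ legendre-* r (- b) ⟩
    legendre r ℤ.* legendre (- b)    ≡⟨ cong (legendre r ℤ.*_) λ-b≡1 ⟩
    legendre r ℤ.* 1ℤ                ≡⟨ ℤP.*-identityʳ _ ⟩
    legendre r                       ∎
    where
      open ≡-Reasoning
      λ-b≡1 : legendre (- b) ≡ 1ℤ
      λ-b≡1 = trans (legendre-neg b) (trans (cong legendre (sym r*r≡b)) (legendre-square r≢0))

  2δr≡1-λr : ℤ.+ 2 ℤ.* δ r ≡ 1ℤ ℤ.- legendre r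
  2δr≡1-λr with legendre-view r
  ... | zero r≡0 _ = ⊥-elim (r≢0 r≡0)
  ... | residue _ _ λr≡1 =
    trans (cong (ℤ.+ 2 ℤ.*_) (when-no (legendre (g r) ℤ.≟ -1ℤ)
                               (λ λgr≡-1 → contradiction (trans (sym (trans λ[gr]≡λr λr≡1)) λgr≡-1) (λ ()))))
          (sym (cong (ℤ._-_ 1ℤ) λr≡1))
  ... | nonresidue _ _ λr≡-1 = trans (cong (ℤ.+ 2 ℤ.*_) (when-yes (legendre (g r) ℤ.≟ -1ℤ) (trans λ[gr]≡λr λr≡-1)))
                                     (sym (cong (ℤ._-_ 1ℤ) λr≡-1))

  A≡Q-5+2λr-8m : ∃ λ m → A ≡ Q ℤ.- ℤ.+ 5 ℤ.+ ℤ.+ 2 ℤ.* legendre r ℤ.- ℤ.+ 8 ℤ.* m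
  A≡Q-5+2λr-8m = halfSum κ E′ , (begin
    A                                                                       ≡⟨ A≡Q-3-2∑δ ⟩
    (Q ℤ.- ℤ.+ 3) ℤ.- ℤ.+ 2 ℤ.* ∑ δ                                         ≡⟨ cong (λ w → (Q ℤ.- ℤ.+ 3) ℤ.- ℤ.+ 2 ℤ.* w) ∑δ≡2δr+4M ⟩
    (Q ℤ.- ℤ.+ 3) ℤ.- ℤ.+ 2 ℤ.* (ℤ.+ 2 ℤ.* δ r ℤ.+ ℤ.+ 4 ℤ.* halfSum κ E′) ≡⟨ regroup Q (δ r) (halfSum κ E′) ⟩
    Q ℤ.- ℤ.+ 5 ℤ.+ ℤ.+ 2 ℤ.* (1ℤ ℤ.- ℤ.+ 2 ℤ.* δ r) ℤ.- ℤ.+ 8 ℤ.* halfSum κ E′ ≡⟨ cong (λ w → Q ℤ.- ℤ.+ 5 ℤ.+ ℤ.+ 2 ℤ.* (1ℤ ℤ.- w) ℤ.- ℤ.+ 8 ℤ.* halfSum κ E′) 2δr≡1-λr ⟩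
    Q ℤ.- ℤ.+ 5 ℤ.+ ℤ.+ 2 ℤ.* (1ℤ ℤ.- (1ℤ ℤ.- legendre r)) ℤ.- ℤ.+ 8 ℤ.* halfSum κ E′ ≡⟨ cong (λ w → Q ℤ.- ℤ.+ 5 ℤ.+ ℤ.+ 2 ℤ.* w ℤ.- ℤ.+ 8 ℤ.* halfSum κ E′) (1-[1-l]≡l (legendre r)) ⟩
    Q ℤ.- ℤ.+ 5 ℤ.+ ℤ.+ 2 ℤ.* legendre r ℤ.- ℤ.+ 8 ℤ.* halfSum κ E′         ∎)
    where
      open ≡-Reasoning
      regroup : ∀ q d m → (q ℤ.- ℤ.+ 3) ℤ.- ℤ.+ 2 ℤ.* (ℤ.+ 2 ℤ.* d ℤ.+ ℤ.+ 4 ℤ.* m)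
                        ≡ q ℤ.- ℤ.+ 5 ℤ.+ ℤ.+ 2 ℤ.* (1ℤ ℤ.- ℤ.+ 2 ℤ.* d) ℤ.- ℤ.+ 8 ℤ.* m
      regroup = solve-∀
      1-[1-l]≡l : ∀ l → 1ℤ ℤ.- (1ℤ ℤ.- l) ≡ l
      1-[1-l]≡l = solve-∀

sgn : ℕ → ℤ
sgn k = -1ℤ ℤ.^ k

sgn≡±1 : ∀ a → sgn a ≡ 1ℤ ⊎ sgn a ≡ -1ℤ
sgn≡±1 zero = inj₁ refl
sgn≡±1 (suc a) with sgn≡±1 a
... | inj₁ sgn≡1 = inj₂ (cong (-1ℤ ℤ.*_) sgn≡1)
... | inj₂ sgn≡-1 = inj₁ (cong (-1ℤ ℤ.*_) sgn≡-1)

sgn≢0 : ∀ a → ¬ sgn a ≡ 0ℤ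
sgn≢0 a sgn≡0 with sgn≡±1 a
... | inj₁ sgn≡1 = contradiction (trans (sym sgn≡0) sgn≡1) (λ ())
... | inj₂ sgn≡-1 = contradiction (trans (sym sgn≡0) sgn≡-1) (λ ())

sgn-suc-suc : ∀ a → sgn (suc (suc a)) ≡ sgn a
sgn-suc-suc a = trans (sym (ℤP.*-assoc -1ℤ -1ℤ (sgn a))) (ℤP.*-identityˡ (sgn a))

sgn-* : ∀ a b → sgn (a ℕ.* b) ≡ sgn a ℤ.^ b
sgn-* a b = sym (ℤP.^-*-assoc -1ℤ a b)

sgn-*-cong : ∀ {a a′ b b′} → sgn a ≡ sgn a′ → sgn b ≡ sgn b′ → sgn (a ℕ.* b) ≡ sgn (a′ ℕ.* b′)
sgn-*-cong {a} {a′} {b} {b′} a≈a′ b≈b′ = begin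
  sgn (a ℕ.* b)       ≡⟨ trans (sgn-* a b) (cong (ℤ._^ b) a≈a′) ⟩
  sgn a′ ℤ.^ b        ≡⟨ trans (sym (sgn-* a′ b)) (cong sgn (ℕP.*-comm a′ b)) ⟩
  sgn (b ℕ.* a′)      ≡⟨ trans (sgn-* b a′) (cong (ℤ._^ a′) b≈b′) ⟩
  sgn b′ ℤ.^ a′       ≡⟨ trans (sym (sgn-* b′ a′)) (cong sgn (ℕP.*-comm b′ a′)) ⟩
  sgn (a′ ℕ.* b′)     ∎
  where open ≡-Reasoning

sgn-square : ∀ a → sgn (a ℕ.* a) ≡ sgn a
sgn-square a with sgn≡±1 a
... | inj₁ sgn≡1 = trans (sgn-* a a) (trans (cong (ℤ._^ a) sgn≡1) (trans (ℤP.^-zeroˡ a) (sym sgn≡1)))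
... | inj₂ sgn≡-1 = trans (sgn-* a a) (cong (ℤ._^ a) sgn≡-1)

-- 3 ^ n = 2 h + 1, and h has the parity of n.
halfPred : ℕ → ℕ
halfPred zero = 0
halfPred (suc n) = suc (3 ℕ.* halfPred n)

3^n≡1+2h : ∀ n → 3 ℕ.^ n ≡ suc (halfPred n ℕ.+ halfPred n)
3^n≡1+2h zero = refl
3^n≡1+2h (suc n) = trans (cong (3 ℕ.*_) (3^n≡1+2h n)) (step (halfPred n))
  where
    step : ∀ h → 3 ℕ.* suc (h ℕ.+ h) ≡ suc (suc (3 ℕ.* h) ℕ.+ suc (3 ℕ.* h))
    step = ℕ-solve-∀

sgn-halfPred : ∀ n → sgn (halfPred n) ≡ sgn n
sgn-halfPred zero = refl
sgn-halfPred (suc n) = cong (-1ℤ ℤ.*_) (begin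
  sgn (3 ℕ.* halfPred n)                      ≡⟨ cong sgn (ℕP.*-comm 3 (halfPred n)) ⟩
  sgn (halfPred n ℕ.* 3)                      ≡⟨ sgn-* (halfPred n) 3 ⟩
  sgn (halfPred n) ℤ.^ 3                      ≡⟨ cong (ℤ._^ 3) (sgn-halfPred n) ⟩
  sgn n ℤ.^ 3                                 ≡⟨ cube (sgn≡±1 n) ⟩
  sgn n                                       ∎)
  where
    open ≡-Reasoning
    cube : ∀ {ε} → ε ≡ 1ℤ ⊎ ε ≡ -1ℤ → ε ℤ.^ 3 ≡ ε
    cube (inj₁ refl) = refl
    cube (inj₂ refl) = refl

-- (1 + 2h) ^ (2j) = 1 + 4 h (h + 1) M with M = 1 + q² + ... + q^(2(j - 1)), q = 1 + 2h.
geometric : ℕ → ℕ → ℕ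
geometric q zero = 0
geometric q (suc j) = suc (q ℕ.* q ℕ.* geometric q j)

odd^2j : ∀ h j → suc (h ℕ.+ h) ℕ.^ (2 ℕ.* j) ≡ suc (4 ℕ.* (h ℕ.* suc h) ℕ.* geometric (suc (h ℕ.+ h)) j)
odd^2j h zero = cong suc (sym (ℕP.*-zeroʳ (4 ℕ.* (h ℕ.* suc h))))
odd^2j h (suc j) = begin
  q ℕ.^ (2 ℕ.* suc j)                                      ≡⟨ trans (cong (q ℕ.^_) (ℕP.*-distribˡ-+ 2 1 j)) (ℕP.^-distribˡ-+-* q 2 (2 ℕ.* j)) ⟩
  q ℕ.* (q ℕ.* 1) ℕ.* q ℕ.^ (2 ℕ.* j)                      ≡⟨ cong (q ℕ.* (q ℕ.* 1) ℕ.*_) (odd^2j h j) ⟩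
  q ℕ.* (q ℕ.* 1) ℕ.* suc (4 ℕ.* (h ℕ.* suc h) ℕ.* geometric q j) ≡⟨ step h (geometric q j) ⟩
  suc (4 ℕ.* (h ℕ.* suc h) ℕ.* geometric q (suc j))   ∎
  where
    open ≡-Reasoning
    q = suc (h ℕ.+ h)
    step : ∀ h M → suc (h ℕ.+ h) ℕ.* (suc (h ℕ.+ h) ℕ.* 1) ℕ.* suc (4 ℕ.* (h ℕ.* suc h) ℕ.* M)
                 ≡ suc (4 ℕ.* (h ℕ.* suc h) ℕ.* suc (suc (h ℕ.+ h) ℕ.* suc (h ℕ.+ h) ℕ.* M))
    step = ℕ-solve-∀

sgn-geometric : ∀ h j → sgn (geometric (suc (h ℕ.+ h)) j) ≡ sgn j
sgn-geometric h zero = refl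
sgn-geometric h (suc j) = cong (-1ℤ ℤ.*_) (begin
  sgn (q ℕ.* q ℕ.* geometric q j)        ≡⟨ sgn-*-cong {q ℕ.* q} {1} {geometric q j} {j} (trans (sgn-square q) sgn-odd) (sgn-geometric h j) ⟩
  sgn (1 ℕ.* j)                          ≡⟨ cong sgn (ℕP.*-identityˡ j) ⟩
  sgn j                                  ∎)
  where
    open ≡-Reasoning
    q = suc (h ℕ.+ h)
    sgn-odd : sgn q ≡ sgn 1
    sgn-odd = trans (cong (-1ℤ ℤ.*_) (trans (ℤP.^-distribˡ-+-* -1ℤ h h) (sgn-square-as-product h))) (ℤP.*-identityʳ -1ℤ)
      where
        sgn-square-as-product : ∀ h → sgn h ℤ.* sgn h ≡ 1ℤ
        sgn-square-as-product h with sgn≡±1 h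
        ... | inj₁ sgn≡1 = cong₂ ℤ._*_ sgn≡1 sgn≡1
        ... | inj₂ sgn≡-1 = cong₂ ℤ._*_ sgn≡-1 sgn≡-1

-- The exponent e with |K| = (3 ^ n) ^ (2 j) = 1 + 2 e.
exponent : ℕ → ℕ → ℕ
exponent n j = 2 ℕ.* (halfPred n ℕ.* suc (halfPred n)) ℕ.* geometric (suc (halfPred n ℕ.+ halfPred n)) j

[3^n]^2j≡1+2e : ∀ n j → (3 ℕ.^ n) ℕ.^ (2 ℕ.* j) ≡ suc (exponent n j ℕ.+ exponent n j)
[3^n]^2j≡1+2e n j = begin
  (3 ℕ.^ n) ℕ.^ (2 ℕ.* j)                           ≡⟨ cong (ℕ._^ (2 ℕ.* j)) (3^n≡1+2h n) ⟩
  suc (h ℕ.+ h) ℕ.^ (2 ℕ.* j)                       ≡⟨ odd^2j h j ⟩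
  suc (4 ℕ.* (h ℕ.* suc h) ℕ.* M)                   ≡⟨ cong suc (double (h ℕ.* suc h) M) ⟩
  suc (exponent n j ℕ.+ exponent n j)               ∎
  where
    open ≡-Reasoning
    h = halfPred n
    M = geometric (suc (h ℕ.+ h)) j
    double : ∀ a M → 4 ℕ.* a ℕ.* M ≡ 2 ℕ.* a ℕ.* M ℕ.+ 2 ℕ.* a ℕ.* M
    double = ℕ-solve-∀

exponent≥1 : ∀ {n j} → 1 ℕ.≤ n → 1 ℕ.≤ j → 1 ℕ.≤ exponent n j
exponent≥1 {suc n} {suc j} _ _ = s≤s z≤n

-[1+2h]≡sgn[1+h]+4k : ∀ h → ∃ λ k → ℤ.- ℤ.+ suc (h ℕ.+ h) ≡ sgn (suc h) ℤ.+ ℤ.+ 4 ℤ.* k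
-[1+2h]≡sgn[1+h]+4k zero = 0ℤ , refl
-[1+2h]≡sgn[1+h]+4k (suc zero) = -1ℤ , refl
-[1+2h]≡sgn[1+h]+4k (suc (suc h)) with -[1+2h]≡sgn[1+h]+4k h
... | k , eq = k ℤ.- 1ℤ , (begin
  ℤ.- ℤ.+ suc (suc (suc h) ℕ.+ suc (suc h))       ≡⟨ cong (λ m → ℤ.- ℤ.+ m) (plus-4 h) ⟩
  ℤ.- ℤ.+ (suc (h ℕ.+ h) ℕ.+ 4)                   ≡⟨ cong ℤ.-_ (ℤP.pos-+ (suc (h ℕ.+ h)) 4) ⟩
  ℤ.- (ℤ.+ suc (h ℕ.+ h) ℤ.+ ℤ.+ 4)               ≡⟨ ℤP.neg-distrib-+ (ℤ.+ suc (h ℕ.+ h)) (ℤ.+ 4) ⟩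
  ℤ.- ℤ.+ suc (h ℕ.+ h) ℤ.- ℤ.+ 4                 ≡⟨ cong (ℤ._- ℤ.+ 4) eq ⟩
  sgn (suc h) ℤ.+ ℤ.+ 4 ℤ.* k ℤ.- ℤ.+ 4           ≡⟨ shift (sgn (suc h)) k ⟩
  sgn (suc h) ℤ.+ ℤ.+ 4 ℤ.* (k ℤ.- 1ℤ)            ≡⟨ cong (ℤ._+ ℤ.+ 4 ℤ.* (k ℤ.- 1ℤ)) (sym (sgn-suc-suc (suc h))) ⟩
  sgn (suc (suc (suc h))) ℤ.+ ℤ.+ 4 ℤ.* (k ℤ.- 1ℤ) ∎)
  where
    open ≡-Reasoning
    plus-4 : ∀ h → suc (suc (suc h) ℕ.+ suc (suc h)) ≡ suc (h ℕ.+ h) ℕ.+ 4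
    plus-4 = ℕ-solve-∀
    shift : ∀ s k → s ℤ.+ ℤ.+ 4 ℤ.* k ℤ.- ℤ.+ 4 ≡ s ℤ.+ ℤ.+ 4 ℤ.* (k ℤ.- 1ℤ)
    shift = solve-∀

[c+4k]^j≡c^j+4k′ : ∀ c k j → ∃ λ k′ → (c ℤ.+ ℤ.+ 4 ℤ.* k) ℤ.^ j ≡ c ℤ.^ j ℤ.+ ℤ.+ 4 ℤ.* k′
[c+4k]^j≡c^j+4k′ c k zero = 0ℤ , refl
[c+4k]^j≡c^j+4k′ c k (suc j) with [c+4k]^j≡c^j+4k′ c k j
... | k′ , eq = c ℤ.* k′ ℤ.+ k ℤ.* c ℤ.^ j ℤ.+ ℤ.+ 4 ℤ.* k ℤ.* k′ ,
                trans (cong ((c ℤ.+ ℤ.+ 4 ℤ.* k) ℤ.*_) eq) (expand c k (c ℤ.^ j) k′)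
  where
    expand : ∀ c k w k′ → (c ℤ.+ ℤ.+ 4 ℤ.* k) ℤ.* (w ℤ.+ ℤ.+ 4 ℤ.* k′)
                        ≡ c ℤ.* w ℤ.+ ℤ.+ 4 ℤ.* (c ℤ.* k′ ℤ.+ k ℤ.* w ℤ.+ ℤ.+ 4 ℤ.* k ℤ.* k′)
    expand = solve-∀

-[1+2h]^j≡sgn+4k : ∀ h j → ∃ λ k → (ℤ.- ℤ.+ suc (h ℕ.+ h)) ℤ.^ j ≡ sgn (suc h ℕ.* j) ℤ.+ ℤ.+ 4 ℤ.* k
-[1+2h]^j≡sgn+4k h j with -[1+2h]≡sgn[1+h]+4k h
... | k , eq with [c+4k]^j≡c^j+4k′ (sgn (suc h)) k j
...   | k′ , eq′ = k′ , trans (cong (ℤ._^ j) eq) (trans eq′ (cong (ℤ._+ ℤ.+ 4 ℤ.* k′) (sym (sgn-* (suc h) j))))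

+q^2j≡[-q]^j*[-q]^j : ∀ q j → ℤ.+ (q ℕ.^ (2 ℕ.* j)) ≡ (ℤ.- ℤ.+ q) ℤ.^ j ℤ.* (ℤ.- ℤ.+ q) ℤ.^ j
+q^2j≡[-q]^j*[-q]^j q zero = refl
+q^2j≡[-q]^j*[-q]^j q (suc j) = begin
  ℤ.+ (q ℕ.^ (2 ℕ.* suc j))                                 ≡⟨ cong ℤ.+_ (trans (cong (q ℕ.^_) (ℕP.*-distribˡ-+ 2 1 j)) (ℕP.^-distribˡ-+-* q 2 (2 ℕ.* j))) ⟩
  ℤ.+ (q ℕ.* (q ℕ.* 1) ℕ.* q ℕ.^ (2 ℕ.* j))                 ≡⟨ ℤP.pos-* (q ℕ.* (q ℕ.* 1)) (q ℕ.^ (2 ℕ.* j)) ⟩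
  ℤ.+ (q ℕ.* (q ℕ.* 1)) ℤ.* ℤ.+ (q ℕ.^ (2 ℕ.* j))           ≡⟨ cong₂ ℤ._*_ (trans (cong (λ m → ℤ.+ (q ℕ.* m)) (ℕP.*-identityʳ q)) (ℤP.pos-* q q))
                                                                       (+q^2j≡[-q]^j*[-q]^j q j) ⟩
  ℤ.+ q ℤ.* ℤ.+ q ℤ.* ((ℤ.- ℤ.+ q) ℤ.^ j ℤ.* (ℤ.- ℤ.+ q) ℤ.^ j) ≡⟨ regroup (ℤ.+ q) ((ℤ.- ℤ.+ q) ℤ.^ j) ⟩
  (ℤ.- ℤ.+ q) ℤ.^ suc j ℤ.* (ℤ.- ℤ.+ q) ℤ.^ suc j          ∎
  where
    open ≡-Reasoning
    regroup : ∀ x w → x ℤ.* x ℤ.* (w ℤ.* w) ≡ (ℤ.- x) ℤ.* w ℤ.* ((ℤ.- x) ℤ.* w)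
    regroup = solve-∀

±-roots : ∀ {a c} → a ℤ.* a ≡ c ℤ.* c → a ≡ c ⊎ a ≡ ℤ.- c
±-roots {a} {c} a²≡c² with ℤP.i*j≡0⇒i≡0∨j≡0 (a ℤ.- c) (begin
  (a ℤ.- c) ℤ.* (a ℤ.+ c)      ≡⟨ difference-of-squares a c ⟩
  a ℤ.* a ℤ.- c ℤ.* c          ≡⟨ cong (ℤ._- c ℤ.* c) a²≡c² ⟩
  c ℤ.* c ℤ.- c ℤ.* c          ≡⟨ ℤP.+-inverseʳ (c ℤ.* c) ⟩
  0ℤ                           ∎)
  where
    open ≡-Reasoning
    difference-of-squares : ∀ a c → (a ℤ.- c) ℤ.* (a ℤ.+ c) ≡ a ℤ.* a ℤ.- c ℤ.* c
    difference-of-squares = solve-∀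
... | inj₁ a-c≡0 = inj₁ (ℤP.i-j≡0⇒i≡j a c a-c≡0)
... | inj₂ a+c≡0 = inj₂ (ℤP.i-j≡0⇒i≡j a (ℤ.- c) (trans (cong (ℤ._+_ a) (ℤP.neg-involutive c)) a+c≡0))

4≢8* : ∀ x → ¬ ℤ.+ 4 ≡ ℤ.+ 8 ℤ.* x
4≢8* x 4≡8x = 8≰4 (Divisibility.∣⇒≤ (Divisibility.divides ℤ.∣ x ∣ (trans (cong ℤ.∣_∣ 4≡8x) (trans (ℤP.abs-* (ℤ.+ 8) x) (ℕP.*-comm 8 ℤ.∣ x ∣)))))
  where
    8≰4 : ¬ 8 ℕ.≤ 4
    8≰4 (s≤s (s≤s (s≤s (s≤s ()))))

-- B = -W would give 4 ≡ 0 (mod 8).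
sign-determined : ∀ {B W l k m} → l ℤ.* l ≡ 1ℤ → W ≡ l ℤ.+ ℤ.+ 4 ℤ.* k → B ℤ.* B ≡ W ℤ.* W →
  (ℤ.- ℤ.+ 2) ℤ.* B ≡ W ℤ.* W ℤ.- ℤ.+ 5 ℤ.+ ℤ.+ 2 ℤ.* l ℤ.- ℤ.+ 8 ℤ.* m → B ≡ W
sign-determined {B} {W} {l} {k} {m} l²≡1 W≡l+4k B²≡W² -2B≡ with ±-roots B²≡W²
... | inj₁ B≡W = B≡W
... | inj₂ refl = ⊥-elim (4≢8* X (begin
  ℤ.+ 4                                             ≡⟨ sym (trans (cong (λ v → ℤ.+ 4 ℤ.+ (1ℤ ℤ.- v)) l²≡1) (ℤP.+-identityʳ (ℤ.+ 4))) ⟩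
  ℤ.+ 4 ℤ.+ (1ℤ ℤ.- l ℤ.* l)                        ≡⟨ identity l k m ⟩
  ℤ.+ 8 ℤ.* X ℤ.+ (-2·[-w] (l ℤ.+ ℤ.+ 4 ℤ.* k) ℤ.- rhs (l ℤ.+ ℤ.+ 4 ℤ.* k)) ≡⟨ cong (λ w → ℤ.+ 8 ℤ.* X ℤ.+ (-2·[-w] w ℤ.- rhs w)) (sym W≡l+4k) ⟩
  ℤ.+ 8 ℤ.* X ℤ.+ (-2·[-w] W ℤ.- rhs W)             ≡⟨ cong (λ v → ℤ.+ 8 ℤ.* X ℤ.+ (v ℤ.- rhs W)) -2B≡ ⟩
  ℤ.+ 8 ℤ.* X ℤ.+ (rhs W ℤ.- rhs W)                 ≡⟨ cong (ℤ._+_ (ℤ.+ 8 ℤ.* X)) (ℤP.+-inverseʳ (rhs W)) ⟩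
  ℤ.+ 8 ℤ.* X ℤ.+ 0ℤ                                ≡⟨ ℤP.+-identityʳ _ ⟩
  ℤ.+ 8 ℤ.* X                                       ∎))
  where
    open ≡-Reasoning
    X : ℤ
    X = l ℤ.* k ℤ.+ ℤ.+ 2 ℤ.* k ℤ.* k ℤ.- k ℤ.- m
    -2·[-w] : ℤ → ℤ
    -2·[-w] w = (ℤ.- ℤ.+ 2) ℤ.* (ℤ.- w)
    rhs : ℤ → ℤ
    rhs w = w ℤ.* w ℤ.- ℤ.+ 5 ℤ.+ ℤ.+ 2 ℤ.* l ℤ.- ℤ.+ 8 ℤ.* m
    identity : ∀ l k m → ℤ.+ 4 ℤ.+ (1ℤ ℤ.- l ℤ.* l)
      ≡ ℤ.+ 8 ℤ.* (l ℤ.* k ℤ.+ ℤ.+ 2 ℤ.* k ℤ.* k ℤ.- k ℤ.- m)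
        ℤ.+ ((ℤ.- ℤ.+ 2) ℤ.* (ℤ.- (l ℤ.+ ℤ.+ 4 ℤ.* k))
             ℤ.- ((l ℤ.+ ℤ.+ 4 ℤ.* k) ℤ.* (l ℤ.+ ℤ.+ 4 ℤ.* k) ℤ.- ℤ.+ 5 ℤ.+ ℤ.+ 2 ℤ.* l ℤ.- ℤ.+ 8 ℤ.* m))
    identity = solve-∀

-- h ≡ n and M ≡ j (mod 2), and (h + 1)² M ≡ (h + 1) M.
sgn-exponent : ∀ n j → let h = halfPred n in
  sgn (suc n ℕ.* (suc h ℕ.* geometric (suc (h ℕ.+ h)) j)) ≡ sgn (suc h ℕ.* j)
sgn-exponent n j = begin
  sgn (suc n ℕ.* (suc h ℕ.* M))        ≡⟨ sgn-*-cong {suc n} {suc h} {suc h ℕ.* M} {suc h ℕ.* M} sgn[1+n]≡sgn[1+h] refl ⟩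
  sgn (suc h ℕ.* (suc h ℕ.* M))        ≡⟨ cong sgn (sym (ℕP.*-assoc (suc h) (suc h) M)) ⟩
  sgn (suc h ℕ.* suc h ℕ.* M)          ≡⟨ sgn-*-cong {suc h ℕ.* suc h} {suc h} {M} {j} (sgn-square (suc h)) (sgn-geometric h j) ⟩
  sgn (suc h ℕ.* j)                    ∎
  where
    open ≡-Reasoning
    h = halfPred n
    M = geometric (suc (h ℕ.+ h)) j
    sgn[1+n]≡sgn[1+h] : sgn (suc n) ≡ sgn (suc h)
    sgn[1+n]≡sgn[1+h] = cong (-1ℤ ℤ.*_) (sym (sgn-halfPred n))

module CubicSumOverExtension
  (n j : ℕ) (n≥1 : n ≥ 1) (j≥1 : j ≥ 1) (K : FiniteField)
  (card≡q^2j : FiniteField.card K ≡ (3 ℕ.^ n) ℕ.^ (2 ℕ.* j))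
  (b : FiniteField.Carrier K) (b^q≡b : FiniteField._^_ K b (3 ℕ.^ n) ≡ b)
  (λq[b]≡sgn : FiniteField.quadChar K (3 ℕ.^ n) b ≡ sgn (suc n))
  where

  h e : ℕ
  h = halfPred n
  e = exponent n j

  M : ℕ
  M = geometric (suc (h ℕ.+ h)) j

  char3 : Characteristic3 K
  char3 = FieldLemmas.card≡3^m⇒characteristic3 K (n ℕ.* (2 ℕ.* j)) (trans card≡q^2j (ℕP.^-*-assoc 3 n (2 ℕ.* j)))

  card≡1+2e : FiniteField.card K ≡ suc (e ℕ.+ e)
  card≡1+2e = trans card≡q^2j ([3^n]^2j≡1+2e n j)

  open QuadraticCharacter K char3 e card≡1+2e (exponent≥1 n≥1 j≥1)

  -1^≡sgn : ∀ k → (sgn k ≡ 1ℤ × (- 1#) ^ k ≡ 1#) ⊎ (sgn k ≡ -1ℤ × (- 1#) ^ k ≡ - 1#)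
  -1^≡sgn zero = inj₁ (refl , refl)
  -1^≡sgn (suc k) with -1^≡sgn k
  ... | inj₁ (sgn≡1 , -1^k≡1) = inj₂ (cong (-1ℤ ℤ.*_) sgn≡1 , trans (cong (- 1# *_) -1^k≡1) (*-identityʳ (- 1#)))
  ... | inj₂ (sgn≡-1 , -1^k≡-1) = inj₁ (cong (-1ℤ ℤ.*_) sgn≡-1 , trans (cong (- 1# *_) -1^k≡-1) -1*-1≡1)

  b≢0 : ¬ b ≡ 0#
  b≢0 b≡0 with quadChar-view (3 ℕ.^ n) b
  ... | zero _ λq[b]≡0 = sgn≢0 (suc n) (trans (sym λq[b]≡sgn) λq[b]≡0)
  ... | residue b≢0 _ _ = b≢0 b≡0
  ... | nonresidue b≢0 _ _ = b≢0 b≡0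

  [q∸1]/2≡h : (3 ℕ.^ n ∸ 1) ℕ./ 2 ≡ h
  [q∸1]/2≡h = trans (cong (λ m → (m ∸ 1) ℕ./ 2) (3^n≡1+2h n)) ([1+2a∸1]/2≡a h)

  b^[h+h]≡1 : b ^ (h ℕ.+ h) ≡ 1#
  b^[h+h]≡1 = *-cancelʳ b b≢0 (trans (*-comm _ b)
                (trans (subst (λ m → b ^ m ≡ b) (3^n≡1+2h n) b^q≡b) (sym (*-identityˡ b))))

  b^h≡-1^[1+n] : b ^ h ≡ (- 1#) ^ suc n
  b^h≡-1^[1+n] with quadChar-view (3 ℕ.^ n) b | -1^≡sgn (suc n)
  ... | zero b≡0 _ | _ = ⊥-elim (b≢0 b≡0)
  ... | residue _ b^≡1 _ | inj₁ (_ , -1^≡1) = trans (subst (λ m → b ^ m ≡ 1#) [q∸1]/2≡h b^≡1) (sym -1^≡1)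
  ... | residue _ _ λ≡1 | inj₂ (sgn≡-1 , _) = contradiction (trans (sym λ≡1) (trans λq[b]≡sgn sgn≡-1)) (λ ())
  ... | nonresidue _ _ λ≡-1 | inj₁ (sgn≡1 , _) = contradiction (trans (sym λ≡-1) (trans λq[b]≡sgn sgn≡1)) (λ ())
  ... | nonresidue _ b^≢1 _ | inj₂ (_ , -1^≡-1) with u*u≡1⇒u≡±1 (trans (sym (^-+ b h h)) b^[h+h]≡1)
  ...   | inj₁ b^h≡1 = ⊥-elim (b^≢1 (subst (λ m → b ^ m ≡ 1#) (sym [q∸1]/2≡h) b^h≡1))
  ...   | inj₂ b^h≡-1 = trans b^h≡-1 (sym -1^≡-1)

  x^[h+h]≡1⇒χx≡1 : ∀ {x} → x ^ (h ℕ.+ h) ≡ 1# → χ x ≡ 1#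
  x^[h+h]≡1⇒χx≡1 {x} x^[h+h]≡1 =
    trans (cong (x ^_) (regroup h M)) (x^a≡1⇒x^ab≡1 (h ℕ.+ h) (suc h ℕ.* M) x^[h+h]≡1)
    where
      regroup : ∀ h M → 2 ℕ.* (h ℕ.* suc h) ℕ.* M ≡ (h ℕ.+ h) ℕ.* (suc h ℕ.* M)
      regroup = ℕ-solve-∀

  -x^[h+h]≡x^[h+h] : ∀ x → (- x) ^ (h ℕ.+ h) ≡ x ^ (h ℕ.+ h)
  -x^[h+h]≡x^[h+h] x = begin
    (- x) ^ (h ℕ.+ h)          ≡⟨ ^-+ (- x) h h ⟩
    (- x) ^ h * (- x) ^ h      ≡⟨ sym (*-^ (- x) (- x) h) ⟩
    (- x * - x) ^ h            ≡⟨ cong (_^ h) (-x*-x≡x*x x) ⟩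
    (x * x) ^ h                ≡⟨ *-^ x x h ⟩
    x ^ h * x ^ h              ≡⟨ sym (^-+ x h h) ⟩
    x ^ (h ℕ.+ h)              ∎
    where open ≡-Reasoning

  λ[-1]≡1 : legendre (- 1#) ≡ 1ℤ
  λ[-1]≡1 = legendre-residue (-‿≢0 (λ 1≡0 → 0≢1 (sym 1≡0)))
              (x^[h+h]≡1⇒χx≡1 (trans (-x^[h+h]≡x^[h+h] 1#) (1^ (h ℕ.+ h))))

  λb≡1 : legendre b ≡ 1ℤ
  λb≡1 = legendre-residue b≢0 (x^[h+h]≡1⇒χx≡1 b^[h+h]≡1)

  λ[-b]≡1 : legendre (- b) ≡ 1ℤ
  λ[-b]≡1 = legendre-residue (-‿≢0 b≢0) (x^[h+h]≡1⇒χx≡1 (trans (-x^[h+h]≡x^[h+h] b) b^[h+h]≡1))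

  s r : Carrier
  s = proj₁ (euler-criterion λ[-b]≡1)
  r = proj₁ (euler-criterion λb≡1)

  r≢0 : ¬ r ≡ 0#
  r≢0 r≡0 = b≢0 (trans (sym (proj₂ (euler-criterion λb≡1))) (trans (cong (_* r) r≡0) (zeroˡ r)))

  χr≡-1^ : χ r ≡ (- 1#) ^ (suc n ℕ.* (suc h ℕ.* M))
  χr≡-1^ = begin
    r ^ e                                       ≡⟨ cong (r ^_) (regroup h M) ⟩
    r ^ (2 ℕ.* (h ℕ.* (suc h ℕ.* M)))           ≡⟨ ^-* r 2 (h ℕ.* (suc h ℕ.* M)) ⟩
    (r * (r * 1#)) ^ (h ℕ.* (suc h ℕ.* M))      ≡⟨ cong (λ w → (r * w) ^ (h ℕ.* (suc h ℕ.* M))) (*-identityʳ r) ⟩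
    (r * r) ^ (h ℕ.* (suc h ℕ.* M))             ≡⟨ cong (_^ (h ℕ.* (suc h ℕ.* M))) (proj₂ (euler-criterion λb≡1)) ⟩
    b ^ (h ℕ.* (suc h ℕ.* M))                   ≡⟨ ^-* b h (suc h ℕ.* M) ⟩
    (b ^ h) ^ (suc h ℕ.* M)                     ≡⟨ cong (_^ (suc h ℕ.* M)) b^h≡-1^[1+n] ⟩
    ((- 1#) ^ suc n) ^ (suc h ℕ.* M)            ≡⟨ sym (^-* (- 1#) (suc n) (suc h ℕ.* M)) ⟩
    (- 1#) ^ (suc n ℕ.* (suc h ℕ.* M))          ∎
    where
      open ≡-Reasoning
      regroup : ∀ h M → 2 ℕ.* (h ℕ.* suc h) ℕ.* M ≡ 2 ℕ.* (h ℕ.* (suc h ℕ.* M))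
      regroup = ℕ-solve-∀

  λr≡sgn : legendre r ≡ sgn (suc h ℕ.* j)
  λr≡sgn = by-sign (-1^≡sgn (suc n ℕ.* (suc h ℕ.* M)))
    where
      by-sign : (sgn (suc n ℕ.* (suc h ℕ.* M)) ≡ 1ℤ × (- 1#) ^ (suc n ℕ.* (suc h ℕ.* M)) ≡ 1#)
              ⊎ (sgn (suc n ℕ.* (suc h ℕ.* M)) ≡ -1ℤ × (- 1#) ^ (suc n ℕ.* (suc h ℕ.* M)) ≡ - 1#) →
              legendre r ≡ sgn (suc h ℕ.* j)
      by-sign (inj₁ (sgn≡1 , -1^≡1)) =
        trans (legendre-residue r≢0 (trans χr≡-1^ -1^≡1)) (sym (trans (sym (sgn-exponent n j)) sgn≡1))
      by-sign (inj₂ (sgn≡-1 , -1^≡-1)) =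
        trans (legendre-nonresidue r≢0 (trans χr≡-1^ -1^≡-1)) (sym (trans (sym (sgn-exponent n j)) sgn≡-1))

  open CubicCharacterSum K char3 e card≡1+2e (exponent≥1 n≥1 j≥1) b b≢0 λ[-1]≡1 s (proj₂ (euler-criterion λ[-b]≡1))
    public using (A; B; A≡-2B; B²≡Q; σ-image; σ-off-image)
  open CubicSumModulo8 K char3 e card≡1+2e (exponent≥1 n≥1 j≥1) b b≢0 λ[-1]≡1 s (proj₂ (euler-criterion λ[-b]≡1))
                       r (proj₂ (euler-criterion λb≡1))
    using (A≡Q-5+2λr-8m)

  W : ℤ
  W = (ℤ.- ℤ.+ (3 ℕ.^ n)) ℤ.^ j

  W≡λr+4k : ∃ λ k → W ≡ legendre r ℤ.+ ℤ.+ 4 ℤ.* k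
  W≡λr+4k = k , trans (cong (λ q → (ℤ.- ℤ.+ q) ℤ.^ j) (3^n≡1+2h n)) (trans W≡sgn+4k (cong (ℤ._+ ℤ.+ 4 ℤ.* k) (sym λr≡sgn)))
    where
      k = proj₁ (-[1+2h]^j≡sgn+4k h j)
      W≡sgn+4k = proj₂ (-[1+2h]^j≡sgn+4k h j)

  Q≡W² : ℤ.+ card ≡ W ℤ.* W
  Q≡W² = trans (cong ℤ.+_ card≡q^2j) (+q^2j≡[-q]^j*[-q]^j (3 ℕ.^ n) j)

  B≡W : B ≡ W
  B≡W = sign-determined (legendre*legendre≡1 r≢0) (proj₂ W≡λr+4k) (trans B²≡Q Q≡W²) -2B≡W²-5+2λr-8m
    where
      m = proj₁ A≡Q-5+2λr-8m
      -2B≡W²-5+2λr-8m : (ℤ.- ℤ.+ 2) ℤ.* B ≡ W ℤ.* W ℤ.- ℤ.+ 5 ℤ.+ ℤ.+ 2 ℤ.* legendre r ℤ.- ℤ.+ 8 ℤ.* m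
      -2B≡W²-5+2λr-8m = trans (sym A≡-2B) (trans (proj₂ A≡Q-5+2λr-8m)
        (cong (λ q → q ℤ.- ℤ.+ 5 ℤ.+ ℤ.+ 2 ℤ.* legendre r ℤ.- ℤ.+ 8 ℤ.* m) Q≡W²))

lemma2p6 : (n j : ℕ) → n ≥ 1 → j ≥ 1
    → (K : FiniteField)
    → FiniteField.card K ≡ (3 ℕ.^ n) ℕ.^ (2 ℕ.* j)
    → let open FiniteField K in
      (b : Carrier)
    → b ^ (3 ℕ.^ n) ≡ b
    → quadChar (3 ℕ.^ n) b ≡ (ℤ.- (ℤ.+ 1)) ℤ.^ (suc n)
    → (t : Carrier)
    → ((∃ λ x → (x ^ 3) + (b * x) ≡ t)
         → sumK (λ x → legendre ((x ^ 3) + (b * x) + t))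
             ≡ (ℤ.- (ℤ.+ 2)) ℤ.* ((ℤ.- (ℤ.+ (3 ℕ.^ n))) ℤ.^ j))
      × ((¬ (∃ λ x → (x ^ 3) + (b * x) ≡ t))
         → sumK (λ x → legendre ((x ^ 3) + (b * x) + t))
             ≡ (ℤ.- (ℤ.+ (3 ℕ.^ n))) ℤ.^ j)
lemma2p6 n j n≥1 j≥1 K card≡q^2j b b^q≡b λq[b]≡sgn t =
  (λ Im-t → trans (σ-image Im-t) (trans A≡-2B (cong ((ℤ.- ℤ.+ 2) ℤ.*_) B≡W))) ,
  (λ ¬Im-t → trans (σ-off-image ¬Im-t) B≡W)
  where open CubicSumOverExtension n j n≥1 j≥1 K card≡q^2j b b^q≡b λq[b]≡sgn
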